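{- Let $p \geq 5$ be a prime and let $\ell_p = \left(\frac{p}{3}\right)$. For $j \in \mathbb{F}_p$ let $f_j(x) = x^2 - 2(j+1)x + (j-1)^2$, and for $k \in \mathbb{F}_p$ let $\epsilon_k = \sum_{x=0}^{p-1} \left(\frac{f_1(x) f_k(x)}{p}\right)$. Let $T$ be the real symmetric $(p+2) \times (p+2)$ matrix with rows and columns indexed by $1, \ldots, p+2$ and entries as follows: - for $1 \leq i, j \leq p-1$: $T_{i,j} = 1 + \left(\frac{f_j(i)}{p}\right)$; - $T_{1,p} = T_{1,p+1} = T_{p,1} = T_{p+1,1} = 0$, and for $2 \leq i \leq p-1$: $T_{i,p} = T_{i,p+1} = T_{p,i} = T_{p+1,i} = 1$; - $T_{p,p} = T_{p+1,p+1} = 0$ and $T_{p,p+1} = T_{p+1,p} = 1$; - $T_{1,p+2} = T_{p+2,1} = \sqrt{p-1}$, and all other entries of row $p+2$ and column $p+2$ (including $T_{p+2,p+2}$) are $0$. Then for $k = 1, \ldots, p+2$, $$[T^2]_{1,k} = \begin{cases} 3p - 6 & \text{if } k = 1,\\ p - 4 + \epsilon_k & \text{if } 2 \leq k \leq p-1,\\ p - 3 - \ell_p & \text{if } k = p \text{ or } k = p+1,\\ (1 + \ell_p)\sqrt{p-1} & \text{if } k = p+2. \end{cases}$$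
   Context: $\left(\frac{a}{p}\right)$ denotes the Legendre symbol modulo $p$, with $\left(\frac{0}{p}\right) = 0$; $\left(\frac{p}{3}\right)$ is the Legendre symbol of $p$ modulo $3$. In the entries $T_{i,j}$, the integers $i, j$ are viewed as elements of $\mathbb{F}_p$. -}

module Defs where

open import Data.Nat as ℕ using (ℕ; zero; suc; _≡ᵇ_; _<ᵇ_)
open import Data.Integer as ℤ using (ℤ; +_; -[1+_])
open import Data.Integer.DivMod using (_%ℕ_)
open import Data.Bool using (Bool; true; false; if_then_else_; _∧_)
open import Data.List using (List; upTo)
open import Data.Bool.ListAction using (any)
open import Algebra.Bundles using (CommutativeRing; Semiring)
import Algebra.Definitions.RawSemiring as RS

-- a mod p, as a natural number in [0, p); (junk value 0 for p = 0)
modℕ : ℤ → ℕ → ℕ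
modℕ a zero = 0
modℕ a (suc n) = a %ℕ suc n

legendre : ℤ → ℕ → ℤ
legendre a p with modℕ a p
... | zero = + 0
... | suc r =
  if any (λ x → modℕ (+ (x ℕ.* x)) p ≡ᵇ suc r) (upTo p) then + 1 else ℤ.- (+ 1)

f : ℤ → ℤ → ℤ
f j x = x ℤ.* x ℤ.- (+ 2) ℤ.* (j ℤ.+ + 1) ℤ.* x ℤ.+ (j ℤ.- + 1) ℤ.* (j ℤ.- + 1)

sumℤ : (ℕ → ℤ) → ℕ → ℤ
sumℤ g zero = + 0
sumℤ g (suc n) = sumℤ g n ℤ.+ g n

ε : ℕ → ℕ → ℤ
ε p k = sumℤ (λ x → legendre (f (+ 1) (+ x) ℤ.* f (+ k) (+ x)) p) p

ℓ : ℕ → ℤ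
ℓ p = legendre (+ p) 3

-- The matrix T (indices 1..p+2) with entries in a commutative ring R
-- containing a chosen element s (playing the role of √(p-1)).
module Mat {c ℓ′} (R : CommutativeRing c ℓ′) (p : ℕ) (s : CommutativeRing.Carrier R) where
  open CommutativeRing R
  open RS (Semiring.rawSemiring semiring) using (_×_)

  ι : ℤ → Carrier
  ι (+ n) = n × 1#
  ι -[1+ n ] = - (suc n × 1#)

  T : ℕ → ℕ → Carrier
  T i j =
    if i ≡ᵇ p ℕ.+ 2 then (if j ≡ᵇ 1 then s else 0#)
    else if j ≡ᵇ p ℕ.+ 2 then (if i ≡ᵇ 1 then s else 0#)
    else if (i <ᵇ p) ∧ (j <ᵇ p) then ι (+ 1 ℤ.+ legendre (f (+ j) (+ i)) p)
    else if i <ᵇ p then (if i ≡ᵇ 1 then 0# else 1#)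
    else if j <ᵇ p then (if j ≡ᵇ 1 then 0# else 1#)
    else if i ≡ᵇ j then 0# else 1#

  sumR : (ℕ → Carrier) → ℕ → Carrier
  sumR g zero = 0#
  sumR g (suc n) = sumR g n + g (suc n)

  T²₁ : ℕ → Carrier
  T²₁ k = sumR (λ m → T 1 m * T m k) (p ℕ.+ 2)

module Submission where

-- Each entry T_{1m} T_{mk} is a product of Legendre symbols (f_m(1)/p)(f_k(m)/p) plus lower terms, so
-- the row of T² reduces to character sums Σ_x (q(x)/p) over quadratics q. Such a sum is -1 whenever the
-- discriminant is non-zero (complete the square and count the solutions of y² = x² - d), and the only
-- other ingredient is (f_1(1)/p) = (-3/p). Finally (-3/p) = (p/3): the map x ↦ 1/(1 - x) has order three
-- on the p + 1 points of the projective line, and its fixed points are the 1 + (-3/p) roots of x² - x + 1.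

open import Data.Nat as ℕ using (ℕ; zero; suc; z≤n; s≤s; _≡ᵇ_)
import Data.Nat.Properties as ℕP
import Data.Nat.Divisibility as ℕD
open import Data.Nat.DivMod using ([m+kn]%n≡m%n)
open import Data.Nat.Primality using (Prime; euclidsLemma)
open import Data.Nat.Coprimality using (prime⇒coprime; coprime-Bézout)
import Data.Nat.GCD as GCD
import Data.Nat.Tactic.RingSolver as ℕSolver
open import Data.Integer as ℤ using (ℤ; +_; -[1+_]; _⊖_; ∣_∣)
import Data.Integer.Properties as ℤP
open import Data.Integer.Divisibility.Signed using (_∣_; divides; ∣ᵤ⇒∣; ∣⇒∣ᵤ)
open import Data.Integer.DivMod using (_%ℕ_; _/ℕ_; a≡a%ℕn+[a/ℕn]*n; n%ℕd<d)
open import Data.Integer.Tactic.RingSolver using (solve-∀)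
open import Data.Bool as Bool using (Bool; true; false; if_then_else_)
open import Data.Unit using (tt)
open import Data.Empty using (⊥-elim)
open import Data.Sum using (_⊎_; inj₁; inj₂; [_,_]′)
open import Data.Product using (Σ; _,_; proj₁; proj₂; _×_)
open import Data.List using (upTo)
open import Data.List.Membership.Propositional using (lose)
open import Data.List.Membership.Propositional.Properties using (∈-upTo⁺)
open import Data.List.Relation.Unary.Any using (satisfied)
open import Data.List.Relation.Unary.Any.Properties using (any⁺; any⁻)
open import Data.Bool.ListAction using (any)
open import Relation.Binary.PropositionalEquality
open import Relation.Binary.Definitions using (tri<; tri≈; tri>)
open import Relation.Nullary using (¬_; Dec; yes; no)
open import Relation.Nullary.Decidable using (dec-true; dec-false)
open import Algebra.Bundles using (CommutativeRing)
open import Algebra.Properties.AbelianGroup ℤP.+-0-abelianGroup using () renaming (∙-cancelˡ to +-cancelˡ)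
import Algebra.Properties.Ring as RingProperties
import Algebra.Properties.Semiring.Mult as MultProperties
open import Defs

𝟙 : ∀ {a} {A : Set a} → Dec A → ℤ
𝟙 (yes _) = + 1
𝟙 (no _) = + 0

module Indicator where
  open import Data.Integer using (_+_)

  𝟙-yes : ∀ {A : Set} (d : Dec A) → A → 𝟙 d ≡ + 1
  𝟙-yes (yes _) _ = refl
  𝟙-yes (no ¬a) a = ⊥-elim (¬a a)

  𝟙-no : ∀ {A : Set} (d : Dec A) → ¬ A → 𝟙 d ≡ + 0
  𝟙-no (yes a) ¬a = ⊥-elim (¬a a)
  𝟙-no (no _) _ = refl

  𝟙-nonneg : ∀ {A : Set} (d : Dec A) → + 0 ℤ.≤ 𝟙 d
  𝟙-nonneg (yes _) = ℤ.+≤+ z≤n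
  𝟙-nonneg (no _) = ℤ.+≤+ z≤n

  𝟙-cong : ∀ {A B : Set} (a : Dec A) (b : Dec B) → (A → B) → (B → A) → 𝟙 a ≡ 𝟙 b
  𝟙-cong (yes _) (yes _) _ _ = refl
  𝟙-cong (yes a) (no ¬b) a⇒b _ = ⊥-elim (¬b (a⇒b a))
  𝟙-cong (no ¬a) (yes b) _ b⇒a = ⊥-elim (¬a (b⇒a b))
  𝟙-cong (no _) (no _) _ _ = refl

  𝟙-disjoint-∪ : ∀ {A B C : Set} (a : Dec A) (b : Dec B) (c : Dec C) →
                 (C → A ⊎ B) → (A → C) → (B → C) → ¬ (A × B) → 𝟙 c ≡ 𝟙 a + 𝟙 b
  𝟙-disjoint-∪ (yes a) (yes b) _ _ _ _ disjoint = ⊥-elim (disjoint (a , b))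
  𝟙-disjoint-∪ (yes _) (no _) (yes _) _ _ _ _ = refl
  𝟙-disjoint-∪ (yes a) (no _) (no ¬c) _ a⇒c _ _ = ⊥-elim (¬c (a⇒c a))
  𝟙-disjoint-∪ (no _) (yes _) (yes _) _ _ _ _ = refl
  𝟙-disjoint-∪ (no _) (yes b) (no ¬c) _ _ b⇒c _ = ⊥-elim (¬c (b⇒c b))
  𝟙-disjoint-∪ (no ¬a) (no ¬b) (yes c) c⇒a⊎b _ _ _ = ⊥-elim ([ ¬a , ¬b ]′ (c⇒a⊎b c))
  𝟙-disjoint-∪ (no _) (no _) (no _) _ _ _ _ = refl

open Indicator

module FiniteSums where
  open import Data.Integer using (_+_; _*_; -_)

  sumℤ-cong : ∀ {g h : ℕ → ℤ} n → (∀ x → x ℕ.< n → g x ≡ h x) → sumℤ g n ≡ sumℤ h n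
  sumℤ-cong zero eq = refl
  sumℤ-cong (suc n) eq = cong₂ _+_ (sumℤ-cong n (λ x x<n → eq x (ℕP.m≤n⇒m≤1+n x<n))) (eq n ℕP.≤-refl)

  sumℤ-+ : ∀ (g h : ℕ → ℤ) n → sumℤ (λ x → g x + h x) n ≡ sumℤ g n + sumℤ h n
  sumℤ-+ g h zero = refl
  sumℤ-+ g h (suc n) = trans (cong (_+ (g n + h n)) (sumℤ-+ g h n)) (interchange (sumℤ g n) (sumℤ h n) (g n) (h n))
    where interchange : ∀ a b c d → (a + b) + (c + d) ≡ (a + c) + (b + d)
          interchange = solve-∀

  sumℤ-neg : ∀ (g : ℕ → ℤ) n → sumℤ (λ x → - g x) n ≡ - sumℤ g n
  sumℤ-neg g zero = refl
  sumℤ-neg g (suc n) = trans (cong (_+ (- g n)) (sumℤ-neg g n)) (sym (ℤP.neg-distrib-+ (sumℤ g n) (g n)))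

  sumℤ-const : ∀ c n → sumℤ (λ _ → c) n ≡ + n * c
  sumℤ-const c zero = refl
  sumℤ-const c (suc n) = trans (cong (_+ c) (sumℤ-const c n)) (step (+ n) c)
    where step : ∀ n c → n * c + c ≡ (+ 1 + n) * c
          step = solve-∀

  sumℤ-1 : ∀ n → sumℤ (λ _ → + 1) n ≡ + n
  sumℤ-1 n = trans (sumℤ-const (+ 1) n) (ℤP.*-identityʳ (+ n))

  sumℤ-zero : ∀ {g : ℕ → ℤ} n → (∀ x → x ℕ.< n → g x ≡ + 0) → sumℤ g n ≡ + 0
  sumℤ-zero n eq = trans (sumℤ-cong n eq) (trans (sumℤ-const (+ 0) n) (ℤP.*-zeroʳ (+ n)))

  sumℤ-suc : ∀ (g : ℕ → ℤ) n → sumℤ g (suc n) ≡ g 0 + sumℤ (λ x → g (suc x)) n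
  sumℤ-suc g zero = trans (ℤP.+-identityˡ (g 0)) (sym (ℤP.+-identityʳ (g 0)))
  sumℤ-suc g (suc n) = trans (cong (_+ g (suc n)) (sumℤ-suc g n)) (ℤP.+-assoc (g 0) _ (g (suc n)))

  sumℤ-swap : ∀ (h : ℕ → ℕ → ℤ) n m →
              sumℤ (λ x → sumℤ (λ y → h x y) m) n ≡ sumℤ (λ y → sumℤ (λ x → h x y) n) m
  sumℤ-swap h zero m = sym (sumℤ-zero m (λ _ _ → refl))
  sumℤ-swap h (suc n) m = trans (cong (_+ sumℤ (h n) m) (sumℤ-swap h n m))
                                (sym (sumℤ-+ (λ y → sumℤ (λ x → h x y) n) (h n) m))

  sumℤ-𝟙* : ∀ {Q : ℕ → Set} (Q? : ∀ x → Dec (Q x)) (g : ℕ → ℤ) n y → y ℕ.< n → Q y →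
            (∀ x → x ℕ.< n → Q x → x ≡ y) → sumℤ (λ x → 𝟙 (Q? x) * g x) n ≡ g y
  sumℤ-𝟙* Q? g zero y () _ _
  sumℤ-𝟙* Q? g (suc n) y y<1+n qy unique with y ℕ.≟ n
  ... | yes refl = trans (cong₂ _+_ (sumℤ-zero n vanish) (cong (_* g n) (𝟙-yes (Q? n) qy)))
                         (trans (ℤP.+-identityˡ _) (ℤP.*-identityˡ (g n)))
    where
      vanish : ∀ x → x ℕ.< n → 𝟙 (Q? x) * g x ≡ + 0
      vanish x x<n = cong (_* g x) (𝟙-no (Q? x) (λ qx → ℕP.<-irrefl (unique x (ℕP.m≤n⇒m≤1+n x<n) qx) x<n))
  ... | no y≢n = trans (cong₂ _+_ (sumℤ-𝟙* Q? g n y (ℕP.≤∧≢⇒< (ℕP.≤-pred y<1+n) y≢n) qy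
                                    (λ x x<n → unique x (ℕP.m≤n⇒m≤1+n x<n)))
                                  (cong (_* g n) (𝟙-no (Q? n) (λ qn → y≢n (sym (unique n ℕP.≤-refl qn))))))
                       (ℤP.+-identityʳ (g y))

  sumℤ-𝟙 : ∀ {Q : ℕ → Set} (Q? : ∀ x → Dec (Q x)) n y → y ℕ.< n → Q y →
           (∀ x → x ℕ.< n → Q x → x ≡ y) → sumℤ (λ x → 𝟙 (Q? x)) n ≡ + 1
  sumℤ-𝟙 Q? n y y<n qy unique =
    trans (sumℤ-cong n (λ x _ → sym (ℤP.*-identityʳ (𝟙 (Q? x))))) (sumℤ-𝟙* Q? (λ _ → + 1) n y y<n qy unique)

  sumℤ-nonneg : ∀ (h : ℕ → ℤ) n → (∀ x → x ℕ.< n → + 0 ℤ.≤ h x) → + 0 ℤ.≤ sumℤ h n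
  sumℤ-nonneg h zero _ = ℤP.≤-refl
  sumℤ-nonneg h (suc n) h≥0 = ℤP.+-mono-≤ (sumℤ-nonneg h n (λ x x<n → h≥0 x (ℕP.m≤n⇒m≤1+n x<n))) (h≥0 n ℕP.≤-refl)

  sumℤ-nonpos : ∀ (h : ℕ → ℤ) n → (∀ x → x ℕ.< n → h x ℤ.≤ + 0) → sumℤ h n ℤ.≤ + 0
  sumℤ-nonpos h zero _ = ℤP.≤-refl
  sumℤ-nonpos h (suc n) h≤0 = ℤP.+-mono-≤ (sumℤ-nonpos h n (λ x x<n → h≤0 x (ℕP.m≤n⇒m≤1+n x<n))) (h≤0 n ℕP.≤-refl)

  private
    nonpos-sum≡0 : ∀ a b → a ℤ.≤ + 0 → b ℤ.≤ + 0 → a + b ≡ + 0 → a ≡ + 0 × b ≡ + 0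
    nonpos-sum≡0 a b a≤0 b≤0 a+b≡0 = a≡0 , trans (trans (sym (ℤP.+-identityˡ b)) (cong (_+ b) (sym a≡0))) a+b≡0
      where
        a≡0 : a ≡ + 0
        a≡0 = ℤP.≤-antisym a≤0 (subst (ℤ._≤ a) a+b≡0 (ℤP.≤-trans (ℤP.+-monoʳ-≤ a b≤0) (ℤP.≤-reflexive (ℤP.+-identityʳ a))))

  sumℤ-nonpos-≡0 : ∀ (h : ℕ → ℤ) n → (∀ x → x ℕ.< n → h x ℤ.≤ + 0) → sumℤ h n ≡ + 0 →
                   ∀ x → x ℕ.< n → h x ≡ + 0
  sumℤ-nonpos-≡0 h (suc n) h≤0 sum≡0 x x<1+n
    with nonpos-sum≡0 (sumℤ h n) (h n) (sumℤ-nonpos h n (λ y y<n → h≤0 y (ℕP.m≤n⇒m≤1+n y<n))) (h≤0 n ℕP.≤-refl) sum≡0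
  ... | init≡0 , last≡0 with x ℕ.≟ n
  ...   | yes refl = last≡0
  ...   | no x≢n = sumℤ-nonpos-≡0 h n (λ y y<n → h≤0 y (ℕP.m≤n⇒m≤1+n y<n)) init≡0 x (ℕP.≤∧≢⇒< (ℕP.≤-pred x<1+n) x≢n)

  -- Both sides equal the double sum of 𝟙[y = σ x] g y.
  sumℤ-permute : ∀ (g : ℕ → ℤ) (σ τ : ℕ → ℕ) n →
                 (∀ x → x ℕ.< n → σ x ℕ.< n) → (∀ y → y ℕ.< n → τ y ℕ.< n) →
                 (∀ x → x ℕ.< n → τ (σ x) ≡ x) → (∀ y → y ℕ.< n → σ (τ y) ≡ y) →
                 sumℤ (λ x → g (σ x)) n ≡ sumℤ g n
  sumℤ-permute g σ τ n σ< τ< τσ στ = begin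
      sumℤ (λ x → g (σ x)) n
        ≡⟨ sumℤ-cong n (λ x x<n → sym (sumℤ-𝟙* (λ y → y ℕ.≟ σ x) g n (σ x) (σ< x x<n) refl (λ _ _ e → e))) ⟩
      sumℤ (λ x → sumℤ (λ y → 𝟙 (y ℕ.≟ σ x) * g y) n) n
        ≡⟨ sumℤ-swap (λ x y → 𝟙 (y ℕ.≟ σ x) * g y) n n ⟩
      sumℤ (λ y → sumℤ (λ x → 𝟙 (y ℕ.≟ σ x) * g y) n) n
        ≡⟨ sumℤ-cong n (λ y y<n → trans (sumℤ-cong n (λ x x<n → cong (_* g y) (preimage x y x<n y<n)))
                                          (sumℤ-𝟙* (λ x → x ℕ.≟ τ y) (λ _ → g y) n (τ y) (τ< y y<n) refl (λ _ _ e → e))) ⟩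
      sumℤ g n ∎
    where
      open ≡-Reasoning
      preimage : ∀ x y → x ℕ.< n → y ℕ.< n → 𝟙 (y ℕ.≟ σ x) ≡ 𝟙 (x ℕ.≟ τ y)
      preimage x y x<n y<n = 𝟙-cong (y ℕ.≟ σ x) (x ℕ.≟ τ y)
        (λ e → trans (sym (τσ x x<n)) (cong τ (sym e))) (λ e → trans (sym (στ y y<n)) (cong σ (sym e)))

  sumℤ-expand : ∀ (u v : ℕ → ℤ) n →
                sumℤ (λ x → (+ 1 + u x) * (+ 1 + v x)) n ≡ + n + sumℤ u n + sumℤ v n + sumℤ (λ x → u x * v x) n
  sumℤ-expand u v n = begin
      sumℤ (λ x → (+ 1 + u x) * (+ 1 + v x)) n
        ≡⟨ sumℤ-cong n (λ x _ → expand (u x) (v x)) ⟩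
      sumℤ (λ x → + 1 + u x + v x + u x * v x) n
        ≡⟨ trans (sumℤ-+ _ _ n) (cong (_+ sumℤ (λ x → u x * v x) n)
             (trans (sumℤ-+ _ _ n) (cong (_+ sumℤ v n) (trans (sumℤ-+ _ _ n) (cong (_+ sumℤ u n) (sumℤ-1 n)))))) ⟩
      + n + sumℤ u n + sumℤ v n + sumℤ (λ x → u x * v x) n ∎
    where
      open ≡-Reasoning
      expand : ∀ u v → (+ 1 + u) * (+ 1 + v) ≡ + 1 + u + v + u * v
      expand = solve-∀

open FiniteSums

-- A map of order three on {0,…,n-1}: every non-fixed point lies in an orbit {x, σ x, σ² x} of size
-- three, and exactly one of the three rotations of that orbit starts at its least element.
module OrderThreeOrbits where
  open import Data.Integer using (_+_; _*_)

  Least : ℕ → ℕ → ℕ → Set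
  Least a b c = a ℕ.< b × a ℕ.< c

  least? : ∀ a b c → Dec (Least a b c)
  least? a b c with a ℕ.<? b | a ℕ.<? c
  ... | yes a<b | yes a<c = yes (a<b , a<c)
  ... | no a≮b | _ = no (λ l → a≮b (proj₁ l))
  ... | yes _ | no a≮c = no (λ l → a≮c (proj₂ l))

  𝟙-least-rotation : ∀ a b c → a ≢ b → b ≢ c → a ≢ c →
                     𝟙 (least? a b c) + 𝟙 (least? b c a) + 𝟙 (least? c a b) ≡ + 1
  𝟙-least-rotation a b c a≢b b≢c a≢c with ℕP.<-cmp a b
  ... | tri≈ _ a≡b _ = ⊥-elim (a≢b a≡b)
  ... | tri< a<b _ _ with ℕP.<-cmp a c
  ...   | tri≈ _ a≡c _ = ⊥-elim (a≢c a≡c)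
  ...   | tri< a<c _ _
    rewrite 𝟙-yes (least? a b c) (a<b , a<c) | 𝟙-no (least? b c a) (λ l → ℕP.<-asym a<b (proj₂ l))
          | 𝟙-no (least? c a b) (λ l → ℕP.<-asym a<c (proj₁ l)) = refl
  ...   | tri> _ _ c<a
    rewrite 𝟙-no (least? a b c) (λ l → ℕP.<-asym c<a (proj₂ l)) | 𝟙-no (least? b c a) (λ l → ℕP.<-asym a<b (proj₂ l))
          | 𝟙-yes (least? c a b) (c<a , ℕP.<-trans c<a a<b) = refl
  𝟙-least-rotation a b c a≢b b≢c a≢c | tri> _ _ b<a with ℕP.<-cmp b c
  ...   | tri≈ _ b≡c _ = ⊥-elim (b≢c b≡c)
  ...   | tri< b<c _ _
    rewrite 𝟙-no (least? a b c) (λ l → ℕP.<-asym b<a (proj₁ l)) | 𝟙-yes (least? b c a) (b<c , b<a)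
          | 𝟙-no (least? c a b) (λ l → ℕP.<-asym b<c (proj₂ l)) = refl
  ...   | tri> _ _ c<b
    rewrite 𝟙-no (least? a b c) (λ l → ℕP.<-asym b<a (proj₁ l)) | 𝟙-no (least? b c a) (λ l → ℕP.<-asym c<b (proj₁ l))
          | 𝟙-yes (least? c a b) (ℕP.<-trans c<b b<a , c<b) = refl

  module _ (σ : ℕ → ℕ) (n : ℕ) (σ< : ∀ x → x ℕ.< n → σ x ℕ.< n) (σ³≡id : ∀ x → x ℕ.< n → σ (σ (σ x)) ≡ x) where

    fixed : ℕ → ℤ
    fixed x = 𝟙 (σ x ℕ.≟ x)

    orbitStart : ℕ → ℤ
    orbitStart x = 𝟙 (least? x (σ x) (σ (σ x)))

    private
      σ²< : ∀ x → x ℕ.< n → σ (σ x) ℕ.< n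
      σ²< x x<n = σ< _ (σ< x x<n)

    fixed-or-orbitStart : ∀ x → x ℕ.< n → + 1 ≡ fixed x + (orbitStart x + orbitStart (σ x) + orbitStart (σ (σ x)))
    fixed-or-orbitStart x x<n with σ x ℕ.≟ x
    ... | yes σx≡x = sym (cong (_+_ (+ 1)) (trans (cong₂ _+_ (cong₂ _+_ (not-least x σx≡x) (not-least (σ x) (cong σ σx≡x)))
                                                                 (not-least (σ (σ x)) (cong σ (cong σ σx≡x)))) refl))
      where
        not-least : ∀ y → σ y ≡ y → orbitStart y ≡ + 0
        not-least y σy≡y = 𝟙-no (least? y (σ y) (σ (σ y))) (λ l → ℕP.<-irrefl (sym σy≡y) (proj₁ l))
    ... | no σx≢x = sym (trans (ℤP.+-identityˡ _) (begin
        orbitStart x + orbitStart (σ x) + orbitStart (σ (σ x))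
          ≡⟨ cong (λ w → orbitStart x + 𝟙 (least? (σ x) (σ (σ x)) w) + 𝟙 (least? (σ (σ x)) w (σ w))) (σ³≡id x x<n) ⟩
        orbitStart x + 𝟙 (least? (σ x) (σ (σ x)) x) + 𝟙 (least? (σ (σ x)) x (σ x))
          ≡⟨ 𝟙-least-rotation x (σ x) (σ (σ x)) (λ e → σx≢x (sym e)) σx≢σ²x x≢σ²x ⟩
        + 1 ∎))
      where
        open ≡-Reasoning
        σx≢σ²x : σ x ≢ σ (σ x)
        σx≢σ²x e = σx≢x (sym (trans (sym (σ³≡id x x<n)) (trans (cong σ (cong σ e)) (cong σ (σ³≡id x x<n)))))
        x≢σ²x : x ≢ σ (σ x)
        x≢σ²x e = σx≢x (trans (cong σ e) (σ³≡id x x<n))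

    orbitStart-σ-invariant : sumℤ (λ x → orbitStart (σ x)) n ≡ sumℤ orbitStart n
    orbitStart-σ-invariant = sumℤ-permute orbitStart σ (λ x → σ (σ x)) n σ< σ²< σ³≡id σ³≡id

    orbitStart-σ²-invariant : sumℤ (λ x → orbitStart (σ (σ x))) n ≡ sumℤ orbitStart n
    orbitStart-σ²-invariant = sumℤ-permute orbitStart (λ x → σ (σ x)) σ n σ²< σ< σ³≡id σ³≡id

    size≡fixed+3*orbits : Σ ℕ (λ c → + n ≡ sumℤ fixed n + + 3 * + c)
    size≡fixed+3*orbits with sumℤ orbitStart n in orbits≡ | sumℤ-nonneg orbitStart n (λ x _ → 𝟙-nonneg _)
    ... | + c | _ = c , (begin
        + n
          ≡⟨ sym (sumℤ-1 n) ⟩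
        sumℤ (λ _ → + 1) n
          ≡⟨ sumℤ-cong n fixed-or-orbitStart ⟩
        sumℤ (λ x → fixed x + (orbitStart x + orbitStart (σ x) + orbitStart (σ (σ x)))) n
          ≡⟨ sumℤ-+ fixed _ n ⟩
        sumℤ fixed n + sumℤ (λ x → orbitStart x + orbitStart (σ x) + orbitStart (σ (σ x))) n
          ≡⟨ cong (_+_ (sumℤ fixed n)) (trans (sumℤ-+ _ _ n) (cong₂ _+_ (sumℤ-+ _ _ n) orbitStart-σ²-invariant)) ⟩
        sumℤ fixed n + (sumℤ orbitStart n + sumℤ (λ x → orbitStart (σ x)) n + sumℤ orbitStart n)
          ≡⟨ cong (λ w → sumℤ fixed n + (sumℤ orbitStart n + w + sumℤ orbitStart n)) orbitStart-σ-invariant ⟩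
        sumℤ fixed n + (sumℤ orbitStart n + sumℤ orbitStart n + sumℤ orbitStart n)
          ≡⟨ cong (λ w → sumℤ fixed n + (w + w + w)) orbits≡ ⟩
        sumℤ fixed n + (+ c + + c + + c)
          ≡⟨ cong (_+_ (sumℤ fixed n)) (triple (+ c)) ⟩
        sumℤ fixed n + + 3 * + c ∎)
      where
        open ≡-Reasoning
        triple : ∀ a → a + a + a ≡ + 3 * a
        triple = solve-∀

isSquareMod : ℕ → ℕ → ℕ → Bool
isSquareMod n r x = modℕ (+ (x ℕ.* x)) n ≡ᵇ r

legendreOfResidue : ℕ → ℕ → ℤ
legendreOfResidue n zero = + 0
legendreOfResidue n (suc r) = if any (isSquareMod n (suc r)) (upTo n) then + 1 else ℤ.- + 1

legendre-residue : ∀ a n → legendre a n ≡ legendreOfResidue n (modℕ a n)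
legendre-residue a n with modℕ a n
... | zero = refl
... | suc r = refl

[n/3]≡1 : ∀ n c → n ≡ 1 ℕ.+ c ℕ.* 3 → legendre (+ n) 3 ≡ + 1
[n/3]≡1 n c n≡1+3c = trans (legendre-residue (+ n) 3) (cong (legendreOfResidue 3) (trans (cong (ℕ._% 3) n≡1+3c) ([m+kn]%n≡m%n 1 c 3)))

[n/3]≡-1 : ∀ n c → suc n ≡ 3 ℕ.* c → legendre (+ n) 3 ≡ ℤ.- + 1
[n/3]≡-1 n (suc c) 1+n≡3c = trans (legendre-residue (+ n) 3) (cong (legendreOfResidue 3) (trans (cong (ℕ._% 3) n≡2+3c) ([m+kn]%n≡m%n 2 c 3)))
  where
    identity : ∀ c → 3 ℕ.* suc c ≡ suc (2 ℕ.+ c ℕ.* 3)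
    identity = ℕSolver.solve-∀
    n≡2+3c : n ≡ 2 ℕ.+ c ℕ.* 3
    n≡2+3c = ℕP.suc-injective (trans 1+n≡3c (identity c))

module Residues (n₀ : ℕ) (p-prime : Prime (suc n₀)) (5≤p : 5 ℕ.≤ suc n₀) where
  open import Data.Integer using (_+_; _*_; -_; _-_)
  open import Relation.Binary.Structures using (IsEquivalence)
  open import Relation.Binary.Bundles using (Setoid)
  import Relation.Binary.Reasoning.Setoid as SetoidReasoning

  p : ℕ
  p = suc n₀

  P : ℤ
  P = + p

  <5⇒<p : ∀ {r} → r ℕ.< 5 → r ℕ.< p
  <5⇒<p r<5 = ℕP.<-≤-trans r<5 5≤p

  infix 4 _≈_

  record _≈_ (a b : ℤ) : Set where
    constructor mk≈
    field
      quotient : ℤ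
      equality : a - b ≡ quotient * P

  ≈-refl : ∀ {a} → a ≈ a
  ≈-refl {a} = mk≈ (+ 0) (ℤP.+-inverseʳ a)

  ≡⇒≈ : ∀ {a b} → a ≡ b → a ≈ b
  ≡⇒≈ refl = ≈-refl

  ≈-by-difference : ∀ {a b c e} → a - b ≡ c - e → a ≈ b → c ≈ e
  ≈-by-difference eq (mk≈ k a-b≡kP) = mk≈ k (trans (sym eq) a-b≡kP)

  ≈-sym : ∀ {a b} → a ≈ b → b ≈ a
  ≈-sym {a} {b} (mk≈ k eq) = mk≈ (- k) (begin
      b - a     ≡⟨ flip b a ⟩
      - (a - b) ≡⟨ cong -_ eq ⟩
      - (k * P) ≡⟨ ℤP.neg-distribˡ-* k P ⟩
      - k * P   ∎)
    where open ≡-Reasoning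
          flip : ∀ b a → b - a ≡ - (a - b)
          flip = solve-∀

  ≈-trans : ∀ {a b c} → a ≈ b → b ≈ c → a ≈ c
  ≈-trans {a} {b} {c} (mk≈ k eq) (mk≈ k′ eq′) = mk≈ (k + k′) (begin
      a - c             ≡⟨ telescope a b c ⟩
      (a - b) + (b - c) ≡⟨ cong₂ _+_ eq eq′ ⟩
      k * P + k′ * P    ≡⟨ ℤP.*-distribʳ-+ P k k′ ⟨
      (k + k′) * P      ∎)
    where open ≡-Reasoning
          telescope : ∀ a b c → a - c ≡ (a - b) + (b - c)
          telescope = solve-∀

  ≈-isEquivalence : IsEquivalence _≈_
  ≈-isEquivalence = record { refl = ≈-refl ; sym = ≈-sym ; trans = ≈-trans }

  ≈-setoid : Setoid _ _
  ≈-setoid = record { isEquivalence = ≈-isEquivalence }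

  module ≈-Reasoning = SetoidReasoning ≈-setoid

  +-cong : ∀ {a b c d} → a ≈ b → c ≈ d → a + c ≈ b + d
  +-cong {a} {b} {c} {d} (mk≈ k eq) (mk≈ k′ eq′) = mk≈ (k + k′) (begin
      (a + c) - (b + d) ≡⟨ regroup a b c d ⟩
      (a - b) + (c - d) ≡⟨ cong₂ _+_ eq eq′ ⟩
      k * P + k′ * P    ≡⟨ ℤP.*-distribʳ-+ P k k′ ⟨
      (k + k′) * P      ∎)
    where open ≡-Reasoning
          regroup : ∀ a b c d → (a + c) - (b + d) ≡ (a - b) + (c - d)
          regroup = solve-∀

  -‿cong : ∀ {a b} → a ≈ b → - a ≈ - b
  -‿cong {a} {b} a≈b = ≈-by-difference (negate a b) (≈-sym a≈b)
    where negate : ∀ a b → b - a ≡ - a - - b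
          negate = solve-∀

  sub-cong : ∀ {a b c d} → a ≈ b → c ≈ d → a - c ≈ b - d
  sub-cong a≈b c≈d = +-cong a≈b (-‿cong c≈d)

  *-congˡ : ∀ {a b} c → a ≈ b → c * a ≈ c * b
  *-congˡ {a} {b} c (mk≈ k eq) = mk≈ (c * k) (begin
      c * a - c * b ≡⟨ factor a b c ⟩
      c * (a - b)   ≡⟨ cong (c *_) eq ⟩
      c * (k * P)   ≡⟨ ℤP.*-assoc c k P ⟨
      c * k * P     ∎)
    where open ≡-Reasoning
          factor : ∀ a b c → c * a - c * b ≡ c * (a - b)
          factor = solve-∀

  *-cong : ∀ {a b c d} → a ≈ b → c ≈ d → a * c ≈ b * d
  *-cong {a} {b} {c} {d} a≈b c≈d = begin
      a * c ≡⟨ ℤP.*-comm a c ⟩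
      c * a ≈⟨ *-congˡ c a≈b ⟩
      c * b ≡⟨ ℤP.*-comm c b ⟩
      b * c ≈⟨ *-congˡ b c≈d ⟩
      b * d ∎
    where open ≈-Reasoning

  private
    ordered-≈⇒≡ : ∀ {r r′} → r′ ℕ.≤ r → r ℕ.< p → + r ≈ + r′ → r ≡ r′
    ordered-≈⇒≡ {r} {r′} r′≤r r<p (mk≈ k eq) with ∣⇒∣ᵤ (divides k eq)
    ... | p∣r-r′ rewrite ℤP.[+m]-[+n]≡m⊖n r r′ | ℤP.⊖-≥ r′≤r with r ℕ.∸ r′ ℕ.≟ 0
    ...   | yes r-r′≡0 = ℕP.≤-antisym (ℕP.m∸n≡0⇒m≤n r-r′≡0) r′≤r
    ...   | no r-r′≢0 = ⊥-elim (ℕP.<⇒≱ r<p (ℕP.≤-trans (ℕD.∣⇒≤ {{ℕ.≢-nonZero r-r′≢0}} p∣r-r′) (ℕP.m∸n≤m r r′)))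

  small-≈⇒≡ : ∀ {r r′} → r ℕ.< p → r′ ℕ.< p → + r ≈ + r′ → r ≡ r′
  small-≈⇒≡ {r} {r′} r<p r′<p r≈r′ with ℕP.≤-total r′ r
  ... | inj₁ r′≤r = ordered-≈⇒≡ r′≤r r<p r≈r′
  ... | inj₂ r≤r′ = sym (ordered-≈⇒≡ r≤r′ r′<p (≈-sym r≈r′))

  mod<p : ∀ a → modℕ a p ℕ.< p
  mod<p a = n%ℕd<d a p

  mod≈ : ∀ a → + (modℕ a p) ≈ a
  mod≈ a = mk≈ (- (a /ℕ p)) (begin
      + (a %ℕ p) - a                             ≡⟨ cong (λ z → + (a %ℕ p) - z) (a≡a%ℕn+[a/ℕn]*n a p) ⟩
      + (a %ℕ p) - (+ (a %ℕ p) + (a /ℕ p) * P) ≡⟨ cancel (+ (a %ℕ p)) (a /ℕ p) P ⟩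
      - (a /ℕ p) * P                             ∎)
    where open ≡-Reasoning
          cancel : ∀ r q P → r - (r + q * P) ≡ - q * P
          cancel = solve-∀

  ≈⇒mod≡ : ∀ {a b} → a ≈ b → modℕ a p ≡ modℕ b p
  ≈⇒mod≡ {a} {b} a≈b = small-≈⇒≡ (mod<p a) (mod<p b) (≈-trans (mod≈ a) (≈-trans a≈b (≈-sym (mod≈ b))))

  mod≡⇒≈ : ∀ {a b} → modℕ a p ≡ modℕ b p → a ≈ b
  mod≡⇒≈ {a} {b} eq = ≈-trans (≈-sym (mod≈ a)) (≈-trans (≡⇒≈ (cong +_ eq)) (mod≈ b))

  mod-small : ∀ {r} → r ℕ.< p → modℕ (+ r) p ≡ r
  mod-small {r} r<p = small-≈⇒≡ (mod<p (+ r)) r<p (mod≈ (+ r))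

  infix 4 _≈?_
  _≈?_ : ∀ a b → Dec (a ≈ b)
  a ≈? b with modℕ a p ℕ.≟ modℕ b p
  ... | yes eq = yes (mod≡⇒≈ eq)
  ... | no neq = no (λ a≈b → neq (≈⇒mod≡ a≈b))

  small≉0 : ∀ {r} → 0 ℕ.< r → r ℕ.< p → ¬ (+ r ≈ + 0)
  small≉0 {suc r} _ r<p r≈0 with small-≈⇒≡ r<p (s≤s z≤n) r≈0
  ... | ()

  1≉0 : ¬ (+ 1 ≈ + 0)
  1≉0 = small≉0 (s≤s z≤n) (<5⇒<p (s≤s (s≤s z≤n)))

  2≉0 : ¬ (+ 2 ≈ + 0)
  2≉0 = small≉0 (s≤s z≤n) (<5⇒<p (s≤s (s≤s (s≤s z≤n))))

  4≉0 : ¬ (+ 4 ≈ + 0)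
  4≉0 = small≉0 (s≤s z≤n) (<5⇒<p (s≤s (s≤s (s≤s (s≤s (s≤s z≤n))))))

  -3≉0 : ¬ (- + 3 ≈ + 0)
  -3≉0 -3≈0 = small≉0 (s≤s z≤n) (<5⇒<p (s≤s (s≤s (s≤s (s≤s z≤n))))) (-‿cong -3≈0)

  p∣⇒≈0 : ∀ {c} → p ℕD.∣ ∣ c ∣ → c ≈ + 0
  p∣⇒≈0 {c} p∣c with ∣ᵤ⇒∣ {P} {c} p∣c
  ... | divides q eq = mk≈ q (trans (ℤP.+-identityʳ c) eq)

  *≈0⇒≈0⊎≈0 : ∀ {a b} → a * b ≈ + 0 → a ≈ + 0 ⊎ b ≈ + 0
  *≈0⇒≈0⊎≈0 {a} {b} (mk≈ k eq) with euclidsLemma ∣ a ∣ ∣ b ∣ p-prime p∣ab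
    where p∣ab : p ℕD.∣ ∣ a ∣ ℕ.* ∣ b ∣
          p∣ab = subst (p ℕD.∣_) (ℤP.abs-* a b) (∣⇒∣ᵤ (divides k (trans (sym (ℤP.+-identityʳ (a * b))) eq)))
  ... | inj₁ p∣a = inj₁ (p∣⇒≈0 p∣a)
  ... | inj₂ p∣b = inj₂ (p∣⇒≈0 p∣b)

  square≈0⇒≈0 : ∀ {a} → a * a ≈ + 0 → a ≈ + 0
  square≈0⇒≈0 {a} a²≈0 = [ (λ a≈0 → a≈0) , (λ a≈0 → a≈0) ]′ (*≈0⇒≈0⊎≈0 {a} {a} a²≈0)

  *-≉0 : ∀ {a b} → ¬ (a ≈ + 0) → ¬ (b ≈ + 0) → ¬ (a * b ≈ + 0)
  *-≉0 a≉0 b≉0 ab≈0 = [ a≉0 , b≉0 ]′ (*≈0⇒≈0⊎≈0 ab≈0)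

  sub≈0⇒≈ : ∀ {a b} → a - b ≈ + 0 → a ≈ b
  sub≈0⇒≈ {a} {b} = ≈-by-difference (ℤP.+-identityʳ (a - b))

  ≈⇒sub≈0 : ∀ {a b} → a ≈ b → a - b ≈ + 0
  ≈⇒sub≈0 {a} {b} = ≈-by-difference (sym (ℤP.+-identityʳ (a - b)))

  *-cancelˡ-≈ : ∀ {c a b} → ¬ (c ≈ + 0) → c * a ≈ c * b → a ≈ b
  *-cancelˡ-≈ {c} {a} {b} c≉0 ca≈cb with *≈0⇒≈0⊎≈0 {c} {a - b} (≈-by-difference (factor c a b) (≈⇒sub≈0 ca≈cb))
    where factor : ∀ c a b → c * a - c * b - + 0 ≡ c * (a - b) - + 0
          factor = solve-∀
  ... | inj₁ c≈0 = ⊥-elim (c≉0 c≈0)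
  ... | inj₂ a-b≈0 = sub≈0⇒≈ a-b≈0

  square-roots : ∀ {x t} → x * x ≈ t * t → x ≈ t ⊎ x ≈ - t
  square-roots {x} {t} x²≈t² with *≈0⇒≈0⊎≈0 {x - t} {x + t} (≈-by-difference (factor x t) (≈⇒sub≈0 x²≈t²))
    where factor : ∀ x t → x * x - t * t - + 0 ≡ (x - t) * (x + t) - + 0
          factor = solve-∀
  ... | inj₁ x-t≈0 = inj₁ (sub≈0⇒≈ x-t≈0)
  ... | inj₂ x+t≈0 = inj₂ (≈-by-difference (negate x t) x+t≈0)
    where negate : ∀ x t → (x + t) - + 0 ≡ x - - t
          negate = solve-∀

  -- Bézout for the coprime pair (p, a mod p).
  inverse-exists : ∀ a → ¬ (a ≈ + 0) → Σ ℤ (λ b → a * b ≈ + 1)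
  inverse-exists a a≉0 with modℕ a p | mod<p a | mod≈ a
  ... | zero | _ | 0≈a = ⊥-elim (a≉0 (≈-sym 0≈a))
  ... | suc n | n<p | r≈a with coprime-Bézout (prime⇒coprime p-prime n<p)
  ...   | GCD.Bézout.Identity.+- x y eq = - + y , ≈-trans (*-cong (≈-sym r≈a) ≈-refl) (mk≈ (- + x) (begin
            + suc n * - + y - + 1      ≡⟨ rearrange (+ suc n) (+ y) ⟩
            - (+ 1 + + y * + suc n)    ≡⟨ cong -_ (trans (cong (_+_ (+ 1)) (sym (ℤP.pos-* y (suc n)))) (sym (ℤP.pos-+ 1 (y ℕ.* suc n)))) ⟩
            - + (1 ℕ.+ y ℕ.* suc n)    ≡⟨ cong -_ (trans (cong +_ eq) (ℤP.pos-* x p)) ⟩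
            - (+ x * P)                ≡⟨ ℤP.neg-distribˡ-* (+ x) P ⟩
            - + x * P                  ∎))
    where open ≡-Reasoning
          rearrange : ∀ n y → n * - y - + 1 ≡ - (+ 1 + y * n)
          rearrange = solve-∀
  ...   | GCD.Bézout.Identity.-+ x y eq = + y , ≈-trans (*-cong (≈-sym r≈a) ≈-refl) (mk≈ (+ x) (begin
            + suc n * + y - + 1        ≡⟨ cong (_- + 1) (trans (ℤP.*-comm (+ suc n) (+ y)) (sym (ℤP.pos-* y (suc n)))) ⟩
            + (y ℕ.* suc n) - + 1      ≡⟨ cong (λ z → + z - + 1) (sym eq) ⟩
            + (1 ℕ.+ x ℕ.* p) - + 1    ≡⟨ cong (_- + 1) (trans (ℤP.pos-+ 1 (x ℕ.* p)) (cong (_+_ (+ 1)) (ℤP.pos-* x p))) ⟩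
            + 1 + + x * P - + 1        ≡⟨ cancel (+ x) P ⟩
            + x * P                    ∎))
    where open ≡-Reasoning
          cancel : ∀ x P → + 1 + x * P - + 1 ≡ x * P
          cancel = solve-∀

  -- Junk value 0 at residues ≈ 0.
  inv : ℤ → ℤ
  inv a with a ≈? + 0
  ... | yes _ = + 0
  ... | no a≉0 = proj₁ (inverse-exists a a≉0)

  *-inverseʳ : ∀ {a} → ¬ (a ≈ + 0) → a * inv a ≈ + 1
  *-inverseʳ {a} a≉0 with a ≈? + 0
  ... | yes a≈0 = ⊥-elim (a≉0 a≈0)
  ... | no a≉0′ = proj₂ (inverse-exists a a≉0′)

  Respects≈ : (ℤ → ℤ) → Set
  Respects≈ G = ∀ {a b} → a ≈ b → G a ≡ G b

  Preserves≈ : (ℤ → ℤ) → Set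
  Preserves≈ σ = ∀ {a b} → a ≈ b → σ a ≈ σ b

  sumℤ-bijection : ∀ (G σ τ : ℤ → ℤ) → Respects≈ G → Preserves≈ σ → Preserves≈ τ →
                   (∀ x → τ (σ x) ≈ x) → (∀ y → σ (τ y) ≈ y) →
                   sumℤ (λ x → G (σ (+ x))) p ≡ sumℤ (λ x → G (+ x)) p
  sumℤ-bijection G σ τ G-resp σ-pres τ-pres τσ στ =
    trans (sumℤ-cong p (λ x _ → G-resp (≈-sym (mod≈ (σ (+ x))))))
          (sumℤ-permute (λ x → G (+ x)) (reduce σ) (reduce τ) p (λ x _ → mod<p (σ (+ x))) (λ x _ → mod<p (τ (+ x)))
             (λ x x<p → trans (≈⇒mod≡ (≈-trans (τ-pres (mod≈ (σ (+ x)))) (τσ (+ x)))) (mod-small x<p))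
             (λ x x<p → trans (≈⇒mod≡ (≈-trans (σ-pres (mod≈ (τ (+ x)))) (στ (+ x)))) (mod-small x<p)))
    where reduce : (ℤ → ℤ) → ℕ → ℕ
          reduce φ x = modℕ (φ (+ x)) p

  sumℤ-affine : ∀ (G : ℤ → ℤ) → Respects≈ G → ∀ c v → ¬ (c ≈ + 0) →
                sumℤ (λ x → G (c * + x + v)) p ≡ sumℤ (λ x → G (+ x)) p
  sumℤ-affine G G-resp c v c≉0 =
    sumℤ-bijection G (λ z → c * z + v) (λ z → inv c * (z - v)) G-resp
      (λ z≈z′ → +-cong (*-congˡ c z≈z′) ≈-refl) (λ z≈z′ → *-congˡ (inv c) (sub-cong z≈z′ ≈-refl))
      (λ z → begin
        inv c * ((c * z + v) - v) ≡⟨ regroup₁ c (inv c) z v ⟩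
        (c * inv c) * z           ≈⟨ *-cong (*-inverseʳ c≉0) ≈-refl ⟩
        + 1 * z                   ≡⟨ ℤP.*-identityˡ z ⟩
        z                         ∎)
      (λ z → begin
        c * (inv c * (z - v)) + v ≡⟨ regroup₂ c (inv c) z v ⟩
        (c * inv c) * (z - v) + v ≈⟨ +-cong (*-cong (*-inverseʳ c≉0) ≈-refl) ≈-refl ⟩
        + 1 * (z - v) + v         ≡⟨ regroup₃ z v ⟩
        z                         ∎)
    where
      open ≈-Reasoning
      regroup₁ : ∀ c i z v → i * ((c * z + v) - v) ≡ (c * i) * z
      regroup₁ = solve-∀
      regroup₂ : ∀ c i z v → c * (i * (z - v)) + v ≡ (c * i) * (z - v) + v
      regroup₂ = solve-∀
      regroup₃ : ∀ z v → + 1 * (z - v) + v ≡ z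
      regroup₃ = solve-∀

  sumℤ-𝟙≈ : ∀ z → sumℤ (λ x → 𝟙 (+ x ≈? z)) p ≡ + 1
  sumℤ-𝟙≈ z = sumℤ-𝟙 (λ x → + x ≈? z) p (modℕ z p) (mod<p z) (mod≈ z)
                (λ x x<p x≈z → trans (sym (mod-small x<p)) (≈⇒mod≡ x≈z))

  χ : ℤ → ℤ
  χ a = legendre a p

  IsSquare : ℤ → Set
  IsSquare a = Σ ℤ (λ x → x * x ≈ a)

  χ-cong : Respects≈ χ
  χ-cong {a} {b} a≈b = trans (legendre-residue a p) (trans (cong (legendreOfResidue p) (≈⇒mod≡ a≈b)) (sym (legendre-residue b p)))

  private
    residue≢0⇒≉0 : ∀ {a r} → modℕ a p ≡ suc r → ¬ (a ≈ + 0)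
    residue≢0⇒≉0 {a} a%p a≈0 with trans (sym a%p) (trans (≈⇒mod≡ a≈0) (mod-small (s≤s z≤n)))
    ... | ()

  data LegendreView (a : ℤ) : Set where
    zero-residue : a ≈ + 0 → χ a ≡ + 0 → LegendreView a
    square       : ¬ (a ≈ + 0) → IsSquare a → χ a ≡ + 1 → LegendreView a
    non-square   : ¬ (a ≈ + 0) → ¬ IsSquare a → χ a ≡ - + 1 → LegendreView a

  legendreView : ∀ a → LegendreView a
  legendreView a with modℕ a p in a%p
  ... | zero = zero-residue (mod≡⇒≈ (trans a%p (sym (mod-small (s≤s z≤n))))) (trans (legendre-residue a p) (cong (legendreOfResidue p) a%p))
  ... | suc r with any (isSquareMod p (suc r)) (upTo p) in found
  ...   | true = square a≉0 (+ x , mod≡⇒≈ (trans (cong (λ z → modℕ z p) (sym (ℤP.pos-* x x))) (trans x²%p (sym a%p)))) χa≡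
    where
      χa≡ : χ a ≡ + 1
      χa≡ = trans (legendre-residue a p) (trans (cong (legendreOfResidue p) a%p) (cong (if_then + 1 else - + 1) found))
      a≉0 = residue≢0⇒≉0 a%p
      witness = satisfied (any⁻ (isSquareMod p (suc r)) (upTo p) (subst Bool.T (sym found) tt))
      x = proj₁ witness
      x²%p : modℕ (+ (x ℕ.* x)) p ≡ suc r
      x²%p = ℕP.≡ᵇ⇒≡ _ _ (proj₂ witness)
  ...   | false = non-square a≉0 no-root χa≡
    where
      χa≡ : χ a ≡ - + 1
      χa≡ = trans (legendre-residue a p) (trans (cong (legendreOfResidue p) a%p) (cong (if_then + 1 else - + 1) found))
      a≉0 = residue≢0⇒≉0 a%p
      no-root : ¬ IsSquare a
      no-root (y , y²≈a) = subst Bool.T found (any⁺ (isSquareMod p (suc r)) (lose (∈-upTo⁺ (mod<p y)) (ℕP.≡⇒≡ᵇ _ _ y′²%p)))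
        where
          y′ = modℕ y p
          y′²%p : modℕ (+ (y′ ℕ.* y′)) p ≡ suc r
          y′²%p = trans (cong (λ z → modℕ z p) (ℤP.pos-* y′ y′))
                        (trans (≈⇒mod≡ (≈-trans (*-cong (mod≈ y) (mod≈ y)) y²≈a)) a%p)

  square⇒χ≡1 : ∀ {a} → ¬ (a ≈ + 0) → IsSquare a → χ a ≡ + 1
  square⇒χ≡1 {a} a≉0 sq with legendreView a
  ... | zero-residue a≈0 _ = ⊥-elim (a≉0 a≈0)
  ... | square _ _ χa≡1 = χa≡1
  ... | non-square _ ¬sq _ = ⊥-elim (¬sq sq)

  non-square⇒χ≡-1 : ∀ {a} → ¬ IsSquare a → χ a ≡ - + 1
  non-square⇒χ≡-1 {a} ¬sq with legendreView a
  ... | zero-residue a≈0 _ = ⊥-elim (¬sq (+ 0 , ≈-sym a≈0))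
  ... | square _ sq _ = ⊥-elim (¬sq sq)
  ... | non-square _ _ χa≡-1 = χa≡-1

  ≈0⇒χ≡0 : ∀ {a} → a ≈ + 0 → χ a ≡ + 0
  ≈0⇒χ≡0 a≈0 = χ-cong a≈0

  χ≤1 : ∀ a → χ a ℤ.≤ + 1
  χ≤1 a with legendreView a
  ... | zero-residue _ χa≡0 = subst (ℤ._≤ + 1) (sym χa≡0) (ℤ.+≤+ z≤n)
  ... | square _ _ χa≡1 = subst (ℤ._≤ + 1) (sym χa≡1) ℤP.≤-refl
  ... | non-square _ _ χa≡-1 = subst (ℤ._≤ + 1) (sym χa≡-1) ℤ.-≤+

  root-count : ∀ a → sumℤ (λ y → 𝟙 (+ y * + y ≈? a)) p ≡ + 1 + χ a
  root-count a with legendreView a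
  ... | zero-residue a≈0 χa≡0 =
    trans (sumℤ-𝟙 (λ y → + y * + y ≈? a) p 0 (s≤s z≤n) (≈-sym a≈0) only-zero) (cong (_+_ (+ 1)) (sym χa≡0))
    where
      only-zero : ∀ y → y ℕ.< p → + y * + y ≈ a → y ≡ 0
      only-zero y y<p y²≈a = trans (sym (mod-small y<p)) (≈⇒mod≡ (square≈0⇒≈0 {+ y} (≈-trans y²≈a a≈0)))
  ... | square a≉0 (t , t²≈a) χa≡1 =
    trans (trans (sumℤ-cong p (λ y _ → 𝟙-disjoint-∪ (+ y ≈? t) (+ y ≈? - t) (+ y * + y ≈? a)
                     (λ y²≈a → square-roots (≈-trans y²≈a (≈-sym t²≈a)))
                     (λ y≈t → ≈-trans (*-cong y≈t y≈t) t²≈a)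
                     (λ y≈-t → ≈-trans (≈-trans (*-cong y≈-t y≈-t) (≡⇒≈ (neg-square t))) t²≈a)
                     (λ (y≈t , y≈-t) → 2t≉0 (≈-by-difference (double t) (≈-trans (≈-sym y≈t) y≈-t)))))
                 (trans (sumℤ-+ _ _ p) (cong₂ _+_ (sumℤ-𝟙≈ t) (sumℤ-𝟙≈ (- t)))))
          (cong (_+_ (+ 1)) (sym χa≡1))
    where
      neg-square : ∀ t → - t * - t ≡ t * t
      neg-square = solve-∀
      double : ∀ t → t - - t ≡ + 2 * t - + 0
      double = solve-∀
      2t≉0 : ¬ (+ 2 * t ≈ + 0)
      2t≉0 = *-≉0 2≉0 (λ t≈0 → a≉0 (≈-trans (≈-sym t²≈a) (*-cong t≈0 t≈0)))
  ... | non-square _ ¬sq χa≡-1 =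
    trans (sumℤ-zero p (λ y _ → 𝟙-no (+ y * + y ≈? a) (λ y²≈a → ¬sq (+ y , y²≈a))))
          (trans (sym (ℤP.+-inverseʳ (+ 1))) (cong (_+_ (+ 1)) (sym χa≡-1)))

  -- Counting the pairs (x, y) with y² ≈ x in two ways.
  sumℤ-χ≡0 : sumℤ (λ x → χ (+ x)) p ≡ + 0
  sumℤ-χ≡0 = +-cancelˡ (+ p) _ _ (begin
      + p + sumℤ (λ x → χ (+ x)) p
        ≡⟨ cong (_+ sumℤ (λ x → χ (+ x)) p) (sumℤ-1 p) ⟨
      sumℤ (λ _ → + 1) p + sumℤ (λ x → χ (+ x)) p
        ≡⟨ sumℤ-+ (λ _ → + 1) (λ x → χ (+ x)) p ⟨
      sumℤ (λ x → + 1 + χ (+ x)) p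
        ≡⟨ sumℤ-cong p (λ x _ → root-count (+ x)) ⟨
      sumℤ (λ x → sumℤ (λ y → 𝟙 (+ y * + y ≈? + x)) p) p
        ≡⟨ sumℤ-swap (λ x y → 𝟙 (+ y * + y ≈? + x)) p p ⟩
      sumℤ (λ y → sumℤ (λ x → 𝟙 (+ y * + y ≈? + x)) p) p
        ≡⟨ sumℤ-cong p (λ y _ → trans (sumℤ-cong p (λ x _ → 𝟙-cong (+ y * + y ≈? + x) (+ x ≈? + y * + y) ≈-sym ≈-sym))
                                       (sumℤ-𝟙≈ (+ y * + y))) ⟩
      sumℤ (λ _ → + 1) p
        ≡⟨ sumℤ-1 p ⟩
      + p
        ≡⟨ ℤP.+-identityʳ (+ p) ⟨
      + p + + 0 ∎)
    where open ≡-Reasoning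

  sumℤ-χ-scaled≡0 : ∀ a → ¬ (a ≈ + 0) → sumℤ (λ x → χ (a * + x)) p ≡ + 0
  sumℤ-χ-scaled≡0 a a≉0 =
    trans (sumℤ-cong p (λ x _ → cong χ (sym (ℤP.+-identityʳ (a * + x)))))
          (trans (sumℤ-affine χ χ-cong a (+ 0) a≉0) sumℤ-χ≡0)

  square*non-square : ∀ {a b} → IsSquare a → ¬ (a ≈ + 0) → ¬ IsSquare b → ¬ IsSquare (a * b)
  square*non-square {a} {b} (s , s²≈a) a≉0 ¬sq-b (z , z²≈ab) = ¬sq-b (z * inv s , (begin
      (z * inv s) * (z * inv s)        ≡⟨ regroup₁ z (inv s) ⟩
      (z * z) * (inv s * inv s)        ≈⟨ *-cong (≈-trans z²≈ab (*-cong (≈-sym s²≈a) ≈-refl)) ≈-refl ⟩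
      ((s * s) * b) * (inv s * inv s)  ≡⟨ regroup₂ s b (inv s) ⟩
      ((s * inv s) * (s * inv s)) * b  ≈⟨ *-cong (*-cong s·s⁻¹≈1 s·s⁻¹≈1) ≈-refl ⟩
      (+ 1 * + 1) * b                  ≡⟨ ℤP.*-identityˡ b ⟩
      b                                ∎))
    where
      open ≈-Reasoning
      s·s⁻¹≈1 : s * inv s ≈ + 1
      s·s⁻¹≈1 = *-inverseʳ {s} (λ s≈0 → a≉0 (≈-trans (≈-sym s²≈a) (*-cong s≈0 s≈0)))
      regroup₁ : ∀ z i → (z * i) * (z * i) ≡ (z * z) * (i * i)
      regroup₁ = solve-∀
      regroup₂ : ∀ s b i → ((s * s) * b) * (i * i) ≡ ((s * i) * (s * i)) * b
      regroup₂ = solve-∀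

  -- χ(a x) + χ(x) ≤ 0 for every x, and the sum over x vanishes; evaluate at x = b.
  non-square*non-square : ∀ {a b} → ¬ IsSquare a → ¬ IsSquare b → χ (a * b) ≡ + 1
  non-square*non-square {a} {b} ¬sq-a ¬sq-b = begin
      χ (a * b)                           ≡⟨ χ-cong (*-congˡ a (≈-sym (mod≈ b))) ⟩
      χ (a * + b′)                        ≡⟨ add-and-subtract (χ (a * + b′)) ⟩
      (χ (a * + b′) + - + 1) + + 1        ≡⟨ cong (λ w → (χ (a * + b′) + w) + + 1) χb′≡-1 ⟨
      (χ (a * + b′) + χ (+ b′)) + + 1     ≡⟨ cong (_+ + 1) (sumℤ-nonpos-≡0 h p h≤0 sum-h≡0 b′ (mod<p b)) ⟩
      + 1                                 ∎
    where
      open ≡-Reasoning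
      a≉0 : ¬ (a ≈ + 0)
      a≉0 a≈0 = ¬sq-a (+ 0 , ≈-sym a≈0)
      b′ = modℕ b p
      h : ℕ → ℤ
      h x = χ (a * + x) + χ (+ x)
      h≤0 : ∀ x → x ℕ.< p → h x ℤ.≤ + 0
      h≤0 x _ with legendreView (+ x)
      ... | zero-residue x≈0 χx≡0 =
        ℤP.≤-reflexive (cong₂ _+_ (≈0⇒χ≡0 (≈-trans (*-congˡ a x≈0) (≡⇒≈ (ℤP.*-zeroʳ a)))) χx≡0)
      ... | square x≉0 sq-x χx≡1 =
        ℤP.≤-reflexive (cong₂ _+_ (trans (cong χ (ℤP.*-comm a (+ x))) (non-square⇒χ≡-1 (square*non-square sq-x x≉0 ¬sq-a))) χx≡1)
      ... | non-square _ _ χx≡-1 =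
        subst (λ w → χ (a * + x) + w ℤ.≤ + 0) (sym χx≡-1) (ℤP.+-monoˡ-≤ (- + 1) (χ≤1 (a * + x)))
      sum-h≡0 : sumℤ h p ≡ + 0
      sum-h≡0 = trans (sumℤ-+ _ _ p) (cong₂ _+_ (sumℤ-χ-scaled≡0 a a≉0) sumℤ-χ≡0)
      χb′≡-1 : χ (+ b′) ≡ - + 1
      χb′≡-1 = trans (χ-cong (mod≈ b)) (non-square⇒χ≡-1 ¬sq-b)
      add-and-subtract : ∀ X → X ≡ (X + - + 1) + + 1
      add-and-subtract = solve-∀

  χ-multiplicative : ∀ a b → χ (a * b) ≡ χ a * χ b
  χ-multiplicative a b with legendreView a | legendreView b
  ... | zero-residue a≈0 χa≡0 | _ rewrite χa≡0 = ≈0⇒χ≡0 (*-cong a≈0 (≈-refl {b}))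
  ... | square _ _ χa≡1 | zero-residue b≈0 χb≡0 rewrite χa≡1 | χb≡0 = ≈0⇒χ≡0 (≈-trans (*-congˡ a b≈0) (≡⇒≈ (ℤP.*-zeroʳ a)))
  ... | non-square _ _ χa≡-1 | zero-residue b≈0 χb≡0 rewrite χa≡-1 | χb≡0 = ≈0⇒χ≡0 (≈-trans (*-congˡ a b≈0) (≡⇒≈ (ℤP.*-zeroʳ a)))
  ... | square a≉0 (s , s²≈a) χa≡1 | square b≉0 (t , t²≈b) χb≡1 rewrite χa≡1 | χb≡1 =
    square⇒χ≡1 (*-≉0 a≉0 b≉0) (s * t , ≈-trans (≡⇒≈ (regroup s t)) (*-cong s²≈a t²≈b))
    where regroup : ∀ s t → (s * t) * (s * t) ≡ (s * s) * (t * t)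
          regroup = solve-∀
  ... | square a≉0 sq-a χa≡1 | non-square _ ¬sq-b χb≡-1 rewrite χa≡1 | χb≡-1 =
    non-square⇒χ≡-1 (square*non-square sq-a a≉0 ¬sq-b)
  ... | non-square _ ¬sq-a χa≡-1 | square b≉0 sq-b χb≡1 rewrite χa≡-1 | χb≡1 =
    trans (cong χ (ℤP.*-comm a b)) (non-square⇒χ≡-1 (square*non-square sq-b b≉0 ¬sq-a))
  ... | non-square _ ¬sq-a χa≡-1 | non-square _ ¬sq-b χb≡-1 rewrite χa≡-1 | χb≡-1 =
    non-square*non-square ¬sq-a ¬sq-b

  𝟙≈-respects : ∀ d → Respects≈ (λ z → 𝟙 (z ≈? d))
  𝟙≈-respects d {a} {b} a≈b = 𝟙-cong (a ≈? d) (b ≈? d) (≈-trans (≈-sym a≈b)) (≈-trans a≈b)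

  sumℤ-𝟙-linear : ∀ c v d → ¬ (c ≈ + 0) → sumℤ (λ y → 𝟙 (c * + y + v ≈? d)) p ≡ + 1
  sumℤ-𝟙-linear c v d c≉0 = trans (sumℤ-affine (λ z → 𝟙 (z ≈? d)) (𝟙≈-respects d) c v c≉0) (sumℤ-𝟙≈ d)

  -- Σ_x (1 + χ(x² - d)) counts the solutions of y² = x² - d; putting x = y + u turns the
  -- equation into 2uy + u² = d, which has one solution y for each u ≠ 0 and none for u = 0.
  sumℤ-χ[x²-d] : ∀ d → ¬ (d ≈ + 0) → sumℤ (λ x → χ (+ x * + x - d)) p ≡ - + 1
  sumℤ-χ[x²-d] d d≉0 = +-cancelˡ (+ p) _ _ (begin
      + p + S                                             ≡⟨ cong (_+ S) (sumℤ-1 p) ⟨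
      sumℤ (λ _ → + 1) p + S                              ≡⟨ sumℤ-+ (λ _ → + 1) _ p ⟨
      sumℤ (λ x → + 1 + χ (+ x * + x - d)) p              ≡⟨ sumℤ-cong p (λ x _ → root-count (+ x * + x - d)) ⟨
      sumℤ (λ x → sumℤ (λ y → G (+ y) (+ x)) p) p         ≡⟨ sumℤ-swap (λ x y → G (+ y) (+ x)) p p ⟩
      sumℤ (λ y → sumℤ (λ x → G (+ y) (+ x)) p) p         ≡⟨ sumℤ-cong p (λ y _ → sym (shift (+ y))) ⟩
      sumℤ (λ y → sumℤ (λ u → G (+ y) (+ 1 * + u + + y)) p) p ≡⟨ sumℤ-cong p (λ y _ → sumℤ-cong p (λ u _ → expand (+ u) (+ y))) ⟩
      sumℤ (λ y → sumℤ (λ u → H (+ u) (+ y)) p) p         ≡⟨ sumℤ-swap (λ y u → H (+ u) (+ y)) p p ⟩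
      sumℤ (λ u → sumℤ (λ y → H (+ u) (+ y)) p) p         ≡⟨ sumℤ-suc _ n₀ ⟩
      sumℤ (λ y → H (+ 0) (+ y)) p + sumℤ (λ u → sumℤ (λ y → H (+ suc u) (+ y)) p) n₀
        ≡⟨ cong₂ _+_ (sumℤ-zero p (λ y _ → no-solution (+ y)))
                     (trans (sumℤ-cong n₀ (λ u u<n₀ → sumℤ-𝟙-linear (+ 2 * + suc u) (+ suc u * + suc u) d
                                                        (*-≉0 2≉0 (small≉0 (s≤s z≤n) (s≤s u<n₀)))))
                            (sumℤ-1 n₀)) ⟩
      + 0 + + n₀                                          ≡⟨ rearrange (+ n₀) ⟩
      + p + - + 1                                         ∎)
    where
      open ≡-Reasoning
      S = sumℤ (λ x → χ (+ x * + x - d)) p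
      G : ℤ → ℤ → ℤ
      G y z = 𝟙 (y * y ≈? z * z - d)
      H : ℤ → ℤ → ℤ
      H u y = 𝟙 ((+ 2 * u) * y + u * u ≈? d)
      shift : ∀ y → sumℤ (λ u → G y (+ 1 * + u + y)) p ≡ sumℤ (λ x → G y (+ x)) p
      shift y = sumℤ-affine (G y) (λ z≈z′ → 𝟙-cong _ _ (λ e → ≈-trans e (sub-cong (*-cong z≈z′ z≈z′) ≈-refl))
                                                        (λ e → ≈-trans e (sub-cong (*-cong (≈-sym z≈z′) (≈-sym z≈z′)) ≈-refl)))
                              (+ 1) y 1≉0
      expand : ∀ u y → G y (+ 1 * u + y) ≡ H u y
      expand u y = 𝟙-cong _ _ (λ e → ≈-by-difference (identity u y d) (≈-sym e)) (λ e → ≈-sym (≈-by-difference (sym (identity u y d)) e))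
        where identity : ∀ u y d → ((+ 1 * u + y) * (+ 1 * u + y) - d) - y * y ≡ ((+ 2 * u) * y + u * u) - d
              identity = solve-∀
      no-solution : ∀ y → H (+ 0) y ≡ + 0
      no-solution y = 𝟙-no _ (λ e → d≉0 (≈-trans (≈-sym e) (≡⇒≈ (vanish y))))
        where vanish : ∀ y → (+ 2 * + 0) * y + + 0 * + 0 ≡ + 0
              vanish = solve-∀
      rearrange : ∀ n → + 0 + n ≡ (+ 1 + n) + - + 1
      rearrange = solve-∀

  χ4≡1 : χ (+ 4) ≡ + 1
  χ4≡1 = square⇒χ≡1 4≉0 (+ 2 , ≈-refl)

  -- Completing the square: 4(x² + bx + c) = (2x + b)² - (b² - 4c), and χ 4 = 1.
  sumℤ-χ-quadratic : ∀ b c → ¬ (b * b - + 4 * c ≈ + 0) → sumℤ (λ x → χ (+ x * + x + b * + x + c)) p ≡ - + 1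
  sumℤ-χ-quadratic b c D≉0 = begin
      sumℤ (λ x → χ (+ x * + x + b * + x + c)) p
        ≡⟨ sumℤ-cong p (λ x _ → complete-square (+ x)) ⟩
      sumℤ (λ x → G (+ 2 * + x + b)) p
        ≡⟨ sumℤ-affine G (λ z≈z′ → χ-cong (sub-cong (*-cong z≈z′ z≈z′) ≈-refl)) (+ 2) b 2≉0 ⟩
      sumℤ (λ x → G (+ x)) p
        ≡⟨ sumℤ-χ[x²-d] D D≉0 ⟩
      - + 1 ∎
    where
      open ≡-Reasoning
      D = b * b - + 4 * c
      G : ℤ → ℤ
      G z = χ (z * z - D)
      identity : ∀ b c x → + 4 * (x * x + b * x + c) ≡ (+ 2 * x + b) * (+ 2 * x + b) - (b * b - + 4 * c)
      identity = solve-∀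
      complete-square : ∀ x → χ (x * x + b * x + c) ≡ G (+ 2 * x + b)
      complete-square x = begin
        χ (x * x + b * x + c)              ≡⟨ ℤP.*-identityˡ _ ⟨
        + 1 * χ (x * x + b * x + c)        ≡⟨ cong (_* χ (x * x + b * x + c)) χ4≡1 ⟨
        χ (+ 4) * χ (x * x + b * x + c)    ≡⟨ χ-multiplicative (+ 4) (x * x + b * x + c) ⟨
        χ (+ 4 * (x * x + b * x + c))      ≡⟨ cong χ (identity b c x) ⟩
        G (+ 2 * x + b)                    ∎

  inv-unique : ∀ {c w} → c * w ≈ + 1 → inv c ≈ w
  inv-unique {c} {w} cw≈1 = begin
      inv c               ≡⟨ ℤP.*-identityʳ (inv c) ⟨
      inv c * + 1         ≈⟨ *-congˡ (inv c) (≈-sym cw≈1) ⟩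
      inv c * (c * w)     ≡⟨ regroup c (inv c) w ⟩
      (c * inv c) * w     ≈⟨ *-cong (*-inverseʳ c≉0) ≈-refl ⟩
      + 1 * w             ≡⟨ ℤP.*-identityˡ w ⟩
      w                   ∎
    where
      open ≈-Reasoning
      c≉0 : ¬ (c ≈ + 0)
      c≉0 c≈0 = 1≉0 (≈-trans (≈-sym cw≈1) (*-cong c≈0 (≈-refl {w})))
      regroup : ∀ c i w → i * (c * w) ≡ (c * i) * w
      regroup = solve-∀

  μ : ℤ → ℤ
  μ a = inv (+ 1 - a)

  private
    1-a≉0 : ∀ {a} → ¬ (a ≈ + 1) → ¬ (+ 1 - a ≈ + 0)
    1-a≉0 {a} a≉1 1-a≈0 = a≉1 (≈-by-difference (flip a) (≈-sym 1-a≈0))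
      where flip : ∀ a → + 0 - (+ 1 - a) ≡ a - + 1
            flip = solve-∀

  μ-inverse : ∀ {a} → ¬ (a ≈ + 1) → (+ 1 - a) * μ a ≈ + 1
  μ-inverse a≉1 = *-inverseʳ (1-a≉0 a≉1)

  μ-cong : ∀ {a b} → ¬ (a ≈ + 1) → a ≈ b → μ a ≈ μ b
  μ-cong {a} {b} a≉1 a≈b = ≈-sym (inv-unique {+ 1 - b} {μ a} (≈-trans (*-cong (sub-cong (≈-refl {+ 1}) (≈-sym a≈b)) (≈-refl {μ a})) (μ-inverse a≉1)))

  μ≉0 : ∀ {a} → ¬ (a ≈ + 1) → ¬ (μ a ≈ + 0)
  μ≉0 {a} a≉1 μa≈0 = 1≉0 (≈-trans (≈-sym (μ-inverse a≉1)) (≈-trans (*-congˡ (+ 1 - a) μa≈0) (≡⇒≈ (ℤP.*-zeroʳ (+ 1 - a)))))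

  μ≉1 : ∀ {a} → ¬ (a ≈ + 0) → ¬ (a ≈ + 1) → ¬ (μ a ≈ + 1)
  μ≉1 {a} a≉0 a≉1 μa≈1 = a≉0 (≈-by-difference (flip a) (≈-sym 1-a≈1))
    where
      flip : ∀ a → + 1 - (+ 1 - a) ≡ a - + 0
      flip = solve-∀
      1-a≈1 : + 1 - a ≈ + 1
      1-a≈1 = ≈-trans (≡⇒≈ (sym (ℤP.*-identityʳ (+ 1 - a)))) (≈-trans (*-congˡ (+ 1 - a) (≈-sym μa≈1)) (μ-inverse a≉1))

  -- With y = μ a and z = μ y one has (1 - y)(1 - z) a = y (1 - a) - y ≈ 1 - y, so (1 - z) a ≈ 1.
  μ³≈id : ∀ {a} → ¬ (a ≈ + 0) → ¬ (a ≈ + 1) → μ (μ (μ a)) ≈ a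
  μ³≈id {a} a≉0 a≉1 = inv-unique {+ 1 - z} {a} (*-cancelˡ-≈ (1-a≉0 y≉1) (begin
      (+ 1 - y) * ((+ 1 - z) * a)      ≡⟨ expand y z a ⟩
      (+ 1 - y) * a - ((+ 1 - y) * z) * a ≈⟨ sub-cong (≈-refl {(+ 1 - y) * a}) (*-cong (μ-inverse y≉1) (≈-refl {a})) ⟩
      (+ 1 - y) * a - + 1 * a          ≡⟨ regroup y a ⟩
      (+ 1 - a) * y - y                ≈⟨ sub-cong (μ-inverse a≉1) ≈-refl ⟩
      + 1 - y                          ≡⟨ ℤP.*-identityʳ (+ 1 - y) ⟨
      (+ 1 - y) * + 1                  ∎))
    where
      open ≈-Reasoning
      y = μ a
      z = μ y
      y≉1 : ¬ (y ≈ + 1)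
      y≉1 = μ≉1 a≉0 a≉1
      expand : ∀ y z a → (+ 1 - y) * ((+ 1 - z) * a) ≡ (+ 1 - y) * a - ((+ 1 - y) * z) * a
      expand = solve-∀
      regroup : ∀ y a → (+ 1 - y) * a - + 1 * a ≡ (+ 1 - a) * y - y
      regroup = solve-∀

  μ-fixed⇔ : ∀ {a} → ¬ (a ≈ + 1) → (μ a ≈ a → a * a - a + + 1 ≈ + 0) × (a * a - a + + 1 ≈ + 0 → μ a ≈ a)
  μ-fixed⇔ {a} a≉1 =
      (λ μa≈a → ≈-by-difference (identity a) (≈-sym (≈-trans (*-congˡ (+ 1 - a) (≈-sym μa≈a)) (μ-inverse a≉1))))
    , (λ q≈0 → inv-unique {+ 1 - a} {a} (≈-sym (≈-by-difference (sym (identity a)) q≈0)))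
    where identity : ∀ a → + 1 - (+ 1 - a) * a ≡ (a * a - a + + 1) - + 0
          identity = solve-∀

  -- μ on the residues 0, …, p-1, with p standing for the point at infinity.
  σ : ℕ → ℕ
  σ x with x ℕ.≟ 1 | x ℕ.≟ p
  ... | yes _ | _ = p
  ... | no _ | yes _ = 0
  ... | no _ | no _ = modℕ (μ (+ x)) p

  private
    p≢1 : p ≢ 1
    p≢1 p≡1 = ℕP.<-irrefl (sym p≡1) (<5⇒<p (s≤s (s≤s z≤n)))

    ≈1⇒≡1 : ∀ {x} → x ℕ.< p → + x ≈ + 1 → x ≡ 1
    ≈1⇒≡1 x<p = small-≈⇒≡ x<p (<5⇒<p (s≤s (s≤s z≤n)))

    ≈0⇒≡0 : ∀ {x} → x ℕ.< p → + x ≈ + 0 → x ≡ 0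
    ≈0⇒≡0 x<p = small-≈⇒≡ x<p (s≤s z≤n)

  σ-1 : σ 1 ≡ p
  σ-1 = refl

  σ-∞ : σ p ≡ 0
  σ-∞ with p ℕ.≟ 1 | p ℕ.≟ p
  ... | yes p≡1 | _ = ⊥-elim (p≢1 p≡1)
  ... | no _ | yes _ = refl
  ... | no _ | no p≢p = ⊥-elim (p≢p refl)

  σ-finite : ∀ {x} → x ≢ 1 → x ℕ.< p → σ x ≡ modℕ (μ (+ x)) p
  σ-finite {x} x≢1 x<p with x ℕ.≟ 1 | x ℕ.≟ p
  ... | yes x≡1 | _ = ⊥-elim (x≢1 x≡1)
  ... | no _ | yes refl = ⊥-elim (ℕP.<-irrefl refl x<p)
  ... | no _ | no _ = refl

  σ-0 : σ 0 ≡ 1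
  σ-0 = trans (σ-finite (λ ()) (s≤s z≤n))
              (trans (≈⇒mod≡ (inv-unique {+ 1 - + 0} {+ 1} ≈-refl)) (mod-small (<5⇒<p (s≤s (s≤s z≤n)))))

  private
    σ-finite≈μ : ∀ {x} → x ≢ 1 → x ℕ.< p → + σ x ≈ μ (+ x)
    σ-finite≈μ x≢1 x<p = ≈-trans (≡⇒≈ (cong +_ (σ-finite x≢1 x<p))) (mod≈ _)

    σ<p : ∀ {x} → x ≢ 1 → x ℕ.< p → σ x ℕ.< p
    σ<p {x} x≢1 x<p = subst (ℕ._< p) (sym (σ-finite x≢1 x<p)) (mod<p (μ (+ x)))

    ≉1 : ∀ {x} → x ≢ 1 → x ℕ.< p → ¬ (+ x ≈ + 1)
    ≉1 x≢1 x<p x≈1 = x≢1 (≈1⇒≡1 x<p x≈1)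

    ≉0 : ∀ {x} → x ≢ 0 → x ℕ.< p → ¬ (+ x ≈ + 0)
    ≉0 x≢0 x<p x≈0 = x≢0 (≈0⇒≡0 x<p x≈0)

    σ-finite-≢1 : ∀ {x} → x ≢ 0 → x ≢ 1 → x ℕ.< p → σ x ≢ 1
    σ-finite-≢1 x≢0 x≢1 x<p σx≡1 = μ≉1 (≉0 x≢0 x<p) (≉1 x≢1 x<p)
                                      (≈-trans (≈-sym (σ-finite≈μ x≢1 x<p)) (≡⇒≈ (cong +_ σx≡1)))

    σ-finite-≢0 : ∀ {x} → x ≢ 1 → x ℕ.< p → σ x ≢ 0
    σ-finite-≢0 x≢1 x<p σx≡0 = μ≉0 (≉1 x≢1 x<p) (≈-trans (≈-sym (σ-finite≈μ x≢1 x<p)) (≡⇒≈ (cong +_ σx≡0)))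

  σ< : ∀ x → x ℕ.< suc p → σ x ℕ.< suc p
  σ< x _ with x ℕ.≟ 1 | x ℕ.≟ p
  ... | yes _ | _ = ℕP.≤-refl
  ... | no _ | yes _ = s≤s z≤n
  ... | no _ | no _ = ℕP.m≤n⇒m≤1+n (mod<p (μ (+ x)))

  σ³≡id : ∀ x → x ℕ.< suc p → σ (σ (σ x)) ≡ x
  σ³≡id x x≤p = by-cases (x ℕ.≟ 1) (x ℕ.≟ p) (x ℕ.≟ 0)
    where
      by-cases : Dec (x ≡ 1) → Dec (x ≡ p) → Dec (x ≡ 0) → σ (σ (σ x)) ≡ x
      by-cases (yes refl) _ _ = trans (cong σ σ-∞) σ-0
      by-cases (no _) (yes refl) _ = trans (cong (λ w → σ (σ w)) σ-∞) (cong σ σ-0)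
      by-cases (no _) (no _) (yes refl) = trans (cong (λ w → σ (σ w)) σ-0) σ-∞
      by-cases (no x≢1) (no x≢p) (no x≢0) = small-≈⇒≡ (σ<p σy≢1 σy<p) x<p (begin
          + σ (σ y)       ≈⟨ σ-finite≈μ σy≢1 σy<p ⟩
          μ (+ σ y)       ≈⟨ μ-cong (≉1 σy≢1 σy<p) (σ-finite≈μ y≢1 y<p) ⟩
          μ (μ (+ y))     ≈⟨ μ-cong (μ≉1 (≉0 (σ-finite-≢0 x≢1 x<p) y<p) (≉1 y≢1 y<p)) (μ-cong (≉1 y≢1 y<p) (σ-finite≈μ x≢1 x<p)) ⟩
          μ (μ (μ (+ x))) ≈⟨ μ³≈id (≉0 x≢0 x<p) (≉1 x≢1 x<p) ⟩
          + x             ∎)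
        where
          open ≈-Reasoning
          x<p : x ℕ.< p
          x<p = ℕP.≤∧≢⇒< (ℕP.≤-pred x≤p) x≢p
          y = σ x
          y<p : y ℕ.< p
          y<p = σ<p x≢1 x<p
          y≢1 : y ≢ 1
          y≢1 = σ-finite-≢1 x≢0 x≢1 x<p
          σy≢1 : σ y ≢ 1
          σy≢1 = σ-finite-≢1 (σ-finite-≢0 x≢1 x<p) y≢1 y<p
          σy<p : σ y ℕ.< p
          σy<p = σ<p y≢1 y<p

  -- 4(x² - x + 1) = (2x - 1)² + 3.
  roots-x²-x+1 : sumℤ (λ x → 𝟙 (+ x * + x - + x + + 1 ≈? + 0)) p ≡ + 1 + χ (- + 3)
  roots-x²-x+1 = begin
      sumℤ (λ x → 𝟙 (+ x * + x - + x + + 1 ≈? + 0)) p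
        ≡⟨ sumℤ-cong p (λ x _ → 𝟙-cong _ _
             (λ q≈0 → ≈-by-difference (identity (+ x)) (*-congˡ (+ 4) q≈0))
             (λ e → *-cancelˡ-≈ 4≉0 (≈-by-difference (sym (identity (+ x))) e))) ⟩
      sumℤ (λ x → G (+ 2 * + x + - + 1)) p
        ≡⟨ sumℤ-affine G (λ z≈z′ → 𝟙-cong _ _ (≈-trans (*-cong (≈-sym z≈z′) (≈-sym z≈z′))) (≈-trans (*-cong z≈z′ z≈z′)))
                       (+ 2) (- + 1) 2≉0 ⟩
      sumℤ (λ y → G (+ y)) p
        ≡⟨ root-count (- + 3) ⟩
      + 1 + χ (- + 3) ∎
    where
      open ≡-Reasoning
      G : ℤ → ℤ
      G z = 𝟙 (z * z ≈? - + 3)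
      identity : ∀ x → + 4 * (x * x - x + + 1) - + 4 * + 0 ≡ (+ 2 * x + - + 1) * (+ 2 * x + - + 1) - - + 3
      identity = solve-∀

  σ-fixed-points : sumℤ (λ x → 𝟙 (σ x ℕ.≟ x)) (suc p) ≡ + 1 + χ (- + 3)
  σ-fixed-points = begin
      sumℤ (λ x → 𝟙 (σ x ℕ.≟ x)) p + 𝟙 (σ p ℕ.≟ p)
        ≡⟨ cong₂ _+_ (sumℤ-cong p (λ x x<p → 𝟙-cong _ _ (fixed⇒root x<p) (root⇒fixed x<p)))
                     (𝟙-no (σ p ℕ.≟ p) (λ σp≡p → 0≢p (trans (sym σ-∞) σp≡p))) ⟩
      sumℤ (λ x → 𝟙 (+ x * + x - + x + + 1 ≈? + 0)) p + + 0
        ≡⟨ ℤP.+-identityʳ _ ⟩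
      sumℤ (λ x → 𝟙 (+ x * + x - + x + + 1 ≈? + 0)) p
        ≡⟨ roots-x²-x+1 ⟩
      + 1 + χ (- + 3) ∎
    where
      open ≡-Reasoning
      0≢p : 0 ≢ p
      0≢p ()
      fixed⇒root : ∀ {x} → x ℕ.< p → σ x ≡ x → + x * + x - + x + + 1 ≈ + 0
      fixed⇒root {x} x<p σx≡x = by-cases (x ℕ.≟ 1)
        where
        by-cases : Dec (x ≡ 1) → + x * + x - + x + + 1 ≈ + 0
        by-cases (yes refl) = ⊥-elim (p≢1 (trans (sym σ-1) σx≡x))
        by-cases (no x≢1) = proj₁ (μ-fixed⇔ (≉1 x≢1 x<p)) (≈-trans (≈-sym (σ-finite≈μ x≢1 x<p)) (≡⇒≈ (cong +_ σx≡x)))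
      root⇒fixed : ∀ {x} → x ℕ.< p → + x * + x - + x + + 1 ≈ + 0 → σ x ≡ x
      root⇒fixed {x} x<p q≈0 = by-cases (x ℕ.≟ 1)
        where
        by-cases : Dec (x ≡ 1) → σ x ≡ x
        by-cases (yes refl) = ⊥-elim (1≉0 q≈0)
        by-cases (no x≢1) = small-≈⇒≡ (σ<p x≢1 x<p) x<p (≈-trans (σ-finite≈μ x≢1 x<p) (proj₂ (μ-fixed⇔ (≉1 x≢1 x<p)) q≈0))

  -- The orbits of σ on the p + 1 points have size 1 or 3, and there are 1 + χ(-3) fixed points,
  -- so p ≡ χ(-3) (mod 3).
  1+p≡fixed+3*orbits : Σ ℕ (λ c → + 1 + + p ≡ (+ 1 + χ (- + 3)) + + 3 * + c)
  1+p≡fixed+3*orbits = c , trans 1+p≡ (cong (_+ + 3 * + c) σ-fixed-points)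
    where
      orbits = OrderThreeOrbits.size≡fixed+3*orbits σ (suc p) σ< σ³≡id
      c = proj₁ orbits
      1+p≡ = proj₂ orbits

  χ[-3]≡[p/3] : χ (- + 3) ≡ legendre (+ p) 3
  χ[-3]≡[p/3] = by-cases (legendreView (- + 3))
    where
      open ≡-Reasoning
      c : ℕ
      c = proj₁ 1+p≡fixed+3*orbits
      counting : + 1 + + p ≡ (+ 1 + χ (- + 3)) + + 3 * + c
      counting = proj₂ 1+p≡fixed+3*orbits
      by-cases : LegendreView (- + 3) → χ (- + 3) ≡ legendre (+ p) 3
      by-cases (zero-residue -3≈0 _) = ⊥-elim (-3≉0 -3≈0)
      by-cases (square _ _ χ≡1) = trans χ≡1 (sym ([n/3]≡1 p c (ℤP.+-injective (+-cancelˡ (+ 1) _ _ (begin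
          + 1 + + p                     ≡⟨ counting ⟩
          (+ 1 + χ (- + 3)) + + 3 * + c ≡⟨ cong (λ w → (+ 1 + w) + + 3 * + c) χ≡1 ⟩
          (+ 1 + + 1) + + 3 * + c       ≡⟨ ℤP.+-assoc (+ 1) (+ 1) (+ 3 * + c) ⟩
          + 1 + (+ 1 + + 3 * + c)       ≡⟨ cong (λ w → + 1 + (+ 1 + w)) (trans (sym (ℤP.pos-* 3 c)) (cong +_ (ℕP.*-comm 3 c))) ⟩
          + 1 + + (1 ℕ.+ c ℕ.* 3)       ∎)))))
      by-cases (non-square _ _ χ≡-1) = trans χ≡-1 (sym ([n/3]≡-1 p c (ℤP.+-injective (begin
          + 1 + + p                     ≡⟨ counting ⟩
          (+ 1 + χ (- + 3)) + + 3 * + c ≡⟨ cong (λ w → (+ 1 + w) + + 3 * + c) χ≡-1 ⟩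
          + 0 + + 3 * + c               ≡⟨ ℤP.+-identityˡ (+ 3 * + c) ⟩
          + 3 * + c                     ≡⟨ ℤP.pos-* 3 c ⟨
          + (3 ℕ.* c)                   ∎))))

  Σ* : (ℕ → ℤ) → ℤ
  Σ* g = sumℤ (λ x → g (suc x)) n₀

  f-symmetric : ∀ a b → f a b ≡ f b a
  f-symmetric = symmetric
    where symmetric : ∀ a b → b * b - + 2 * (a + + 1) * b + (a - + 1) * (a - + 1)
                            ≡ a * a - + 2 * (b + + 1) * a + (b - + 1) * (b - + 1)
          symmetric = solve-∀

  -- f_j has discriminant 16 j.
  sumℤ-χ-f : ∀ j → ¬ (j ≈ + 0) → sumℤ (λ x → χ (f j (+ x))) p ≡ - + 1
  sumℤ-χ-f j j≉0 =
    trans (sumℤ-cong p (λ x _ → cong χ (normal-form j (+ x))))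
          (sumℤ-χ-quadratic (- (+ 2 * (j + + 1))) ((j - + 1) * (j - + 1))
             (λ D≈0 → *-≉0 16≉0 j≉0 (≈-trans (≡⇒≈ (sym (discriminant j))) D≈0)))
    where
      normal-form : ∀ j x → x * x - + 2 * (j + + 1) * x + (j - + 1) * (j - + 1) ≡ x * x + - (+ 2 * (j + + 1)) * x + (j - + 1) * (j - + 1)
      normal-form = solve-∀
      discriminant : ∀ j → - (+ 2 * (j + + 1)) * - (+ 2 * (j + + 1)) - + 4 * ((j - + 1) * (j - + 1)) ≡ + 16 * j
      discriminant = solve-∀
      16≉0 : ¬ (+ 16 ≈ + 0)
      16≉0 = *-≉0 {+ 2} {+ 8} 2≉0 (*-≉0 {+ 2} {+ 4} 2≉0 4≉0)

  Σ*-χ-f₁ : Σ* (λ m → χ (f (+ 1) (+ m))) ≡ - + 1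
  Σ*-χ-f₁ = trans (sym (ℤP.+-identityˡ _)) (trans (sym (sumℤ-suc (λ x → χ (f (+ 1) (+ x))) n₀)) (sumℤ-χ-f (+ 1) 1≉0))

  -- f_k(0) = (k - 1)² is a non-zero square for 2 ≤ k < p.
  Σ*-χ-f : ∀ k → 2 ℕ.≤ k → k ℕ.< p → Σ* (λ m → χ (f (+ k) (+ m))) ≡ - + 2
  Σ*-χ-f k 2≤k k<p = +-cancelˡ (+ 1) _ _ (begin
      + 1 + Σ* (λ m → χ (f (+ k) (+ m)))                 ≡⟨ cong (_+ Σ* (λ m → χ (f (+ k) (+ m)))) χ-f-at-0 ⟨
      χ (f (+ k) (+ 0)) + Σ* (λ m → χ (f (+ k) (+ m)))   ≡⟨ sumℤ-suc (λ x → χ (f (+ k) (+ x))) n₀ ⟨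
      sumℤ (λ x → χ (f (+ k) (+ x))) p                   ≡⟨ sumℤ-χ-f (+ k) (small≉0 (ℕP.<-trans (s≤s z≤n) 2≤k) k<p) ⟩
      - + 1                                               ∎)
    where
      open ≡-Reasoning
      at-0 : ∀ k → + 0 * + 0 - + 2 * (k + + 1) * + 0 + (k - + 1) * (k - + 1) ≡ (k - + 1) * (k - + 1)
      at-0 = solve-∀
      k-1≉0 : ¬ (+ k - + 1 ≈ + 0)
      k-1≉0 k-1≈0 = ℕP.<-irrefl (sym (small-≈⇒≡ k<p (<5⇒<p (s≤s (s≤s z≤n))) (sub≈0⇒≈ k-1≈0))) 2≤k
      χ-f-at-0 : χ (f (+ k) (+ 0)) ≡ + 1
      χ-f-at-0 = trans (cong χ (at-0 (+ k))) (square⇒χ≡1 (*-≉0 k-1≉0 k-1≉0) (+ k - + 1 , ≈-refl))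

  χ² : ∀ a → χ a * χ a ≡ + 1 - 𝟙 (a ≈? + 0)
  χ² a with legendreView a
  ... | zero-residue a≈0 χa≡0 rewrite χa≡0 | 𝟙-yes (a ≈? + 0) a≈0 = refl
  ... | square a≉0 _ χa≡1 rewrite χa≡1 | 𝟙-no (a ≈? + 0) a≉0 = refl
  ... | non-square a≉0 _ χa≡-1 rewrite χa≡-1 | 𝟙-no (a ≈? + 0) a≉0 = refl

  -- f_1(x) = x (x - 4).
  roots-f₁ : sumℤ (λ x → 𝟙 (f (+ 1) (+ x) ≈? + 0)) p ≡ + 2
  roots-f₁ =
    trans (sumℤ-cong p (λ x _ → 𝟙-disjoint-∪ (+ x ≈? + 0) (+ x ≈? + 4) (f (+ 1) (+ x) ≈? + 0)
             (λ f≈0 → [ inj₁ , (λ x-4≈0 → inj₂ (sub≈0⇒≈ x-4≈0)) ]′ (*≈0⇒≈0⊎≈0 (≈-trans (≡⇒≈ (sym (factor (+ x)))) f≈0)))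
             (λ x≈0 → ≈-trans (≡⇒≈ (factor (+ x))) (≈-trans (*-cong x≈0 (≈-refl {+ x - + 4})) (≡⇒≈ refl)))
             (λ x≈4 → ≈-trans (≡⇒≈ (factor (+ x))) (≈-trans (*-congˡ (+ x) (≈⇒sub≈0 x≈4)) (≡⇒≈ (ℤP.*-zeroʳ (+ x)))))
             (λ (x≈0 , x≈4) → 4≉0 (≈-trans (≈-sym x≈4) x≈0))))
          (trans (sumℤ-+ _ _ p) (cong₂ _+_ (sumℤ-𝟙≈ (+ 0)) (sumℤ-𝟙≈ (+ 4))))
    where factor : ∀ x → x * x - + 2 * (+ 1 + + 1) * x + (+ 1 - + 1) * (+ 1 - + 1) ≡ x * (x - + 4)
          factor = solve-∀

  Σ*-χ-f₁² : Σ* (λ m → χ (f (+ 1) (+ m)) * χ (f (+ 1) (+ m))) ≡ + p - + 2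
  Σ*-χ-f₁² = begin
      Σ* (λ m → χ (f (+ 1) (+ m)) * χ (f (+ 1) (+ m)))
        ≡⟨ ℤP.+-identityˡ _ ⟨
      + 0 + Σ* (λ m → χ (f (+ 1) (+ m)) * χ (f (+ 1) (+ m)))
        ≡⟨ sumℤ-suc (λ x → χ (f (+ 1) (+ x)) * χ (f (+ 1) (+ x))) n₀ ⟨
      sumℤ (λ x → χ (f (+ 1) (+ x)) * χ (f (+ 1) (+ x))) p
        ≡⟨ sumℤ-cong p (λ x _ → χ² (f (+ 1) (+ x))) ⟩
      sumℤ (λ x → + 1 - 𝟙 (f (+ 1) (+ x) ≈? + 0)) p
        ≡⟨ trans (sumℤ-+ _ _ p) (cong₂ _+_ (sumℤ-1 p) (trans (sumℤ-neg _ p) (cong -_ roots-f₁))) ⟩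
      + p - + 2 ∎
    where open ≡-Reasoning

  Σ*-χ-f₁·χ-f≡ε : ∀ k → Σ* (λ m → χ (f (+ 1) (+ m)) * χ (f (+ k) (+ m))) ≡ ε p k
  Σ*-χ-f₁·χ-f≡ε k = begin
      Σ* (λ m → χ (f (+ 1) (+ m)) * χ (f (+ k) (+ m)))
        ≡⟨ sumℤ-cong n₀ (λ x _ → χ-multiplicative (f (+ 1) (+ suc x)) (f (+ k) (+ suc x))) ⟨
      Σ* (λ m → χ (f (+ 1) (+ m) * f (+ k) (+ m)))
        ≡⟨ ℤP.+-identityˡ _ ⟨
      + 0 + Σ* (λ m → χ (f (+ 1) (+ m) * f (+ k) (+ m)))
        ≡⟨ sumℤ-suc (λ x → χ (f (+ 1) (+ x) * f (+ k) (+ x))) n₀ ⟨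
      ε p k ∎
    where open ≡-Reasoning

  private
    χf₁ : ℕ → ℤ
    χf₁ m = χ (f (+ 1) (+ m))

    χf₁-symmetric : ∀ m → χ (f (+ m) (+ 1)) ≡ χf₁ m
    χf₁-symmetric m = cong χ (f-symmetric (+ m) (+ 1))

  column₁-sum : Σ* (λ m → (+ 1 + χ (f (+ m) (+ 1))) * (+ 1 + χ (f (+ 1) (+ m)))) + + n₀ ≡ + (3 ℕ.* p) - + 6
  column₁-sum = begin
      Σ* (λ m → (+ 1 + χ (f (+ m) (+ 1))) * (+ 1 + χf₁ m)) + + n₀
        ≡⟨ cong (_+ + n₀) (sumℤ-cong n₀ (λ x _ → cong (λ w → (+ 1 + w) * (+ 1 + χf₁ (suc x))) (χf₁-symmetric (suc x)))) ⟩
      Σ* (λ m → (+ 1 + χf₁ m) * (+ 1 + χf₁ m)) + + n₀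
        ≡⟨ cong (_+ + n₀) (sumℤ-expand (λ x → χf₁ (suc x)) (λ x → χf₁ (suc x)) n₀) ⟩
      + n₀ + Σ* χf₁ + Σ* χf₁ + Σ* (λ m → χf₁ m * χf₁ m) + + n₀
        ≡⟨ cong (λ w → + n₀ + w + w + Σ* (λ m → χf₁ m * χf₁ m) + + n₀) Σ*-χ-f₁ ⟩
      + n₀ + - + 1 + - + 1 + Σ* (λ m → χf₁ m * χf₁ m) + + n₀
        ≡⟨ cong (λ w → + n₀ + - + 1 + - + 1 + w + + n₀) Σ*-χ-f₁² ⟩
      + n₀ + - + 1 + - + 1 + (+ 1 + + n₀ - + 2) + + n₀
        ≡⟨ arithmetic (+ n₀) ⟩
      + 3 * (+ 1 + + n₀) - + 6
        ≡⟨ cong (_- + 6) (ℤP.pos-* 3 p) ⟨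
      + (3 ℕ.* p) - + 6 ∎
    where
      open ≡-Reasoning
      arithmetic : ∀ n → n + - + 1 + - + 1 + (+ 1 + n - + 2) + n ≡ + 3 * (+ 1 + n) - + 6
      arithmetic = solve-∀

  column-sum : ∀ k → 2 ℕ.≤ k → k ℕ.< p →
               Σ* (λ m → (+ 1 + χ (f (+ m) (+ 1))) * (+ 1 + χ (f (+ k) (+ m)))) ≡ + p - + 4 + ε p k
  column-sum k 2≤k k<p = begin
      Σ* (λ m → (+ 1 + χ (f (+ m) (+ 1))) * (+ 1 + χf m))
        ≡⟨ sumℤ-cong n₀ (λ x _ → cong (λ w → (+ 1 + w) * (+ 1 + χf (suc x))) (χf₁-symmetric (suc x))) ⟩
      Σ* (λ m → (+ 1 + χf₁ m) * (+ 1 + χf m))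
        ≡⟨ sumℤ-expand (λ x → χf₁ (suc x)) (λ x → χf (suc x)) n₀ ⟩
      + n₀ + Σ* χf₁ + Σ* χf + Σ* (λ m → χf₁ m * χf m)
        ≡⟨ cong₂ (λ u v → + n₀ + u + v + Σ* (λ m → χf₁ m * χf m)) Σ*-χ-f₁ (Σ*-χ-f k 2≤k k<p) ⟩
      + n₀ + - + 1 + - + 2 + Σ* (λ m → χf₁ m * χf m)
        ≡⟨ cong (λ w → + n₀ + - + 1 + - + 2 + w) (Σ*-χ-f₁·χ-f≡ε k) ⟩
      + n₀ + - + 1 + - + 2 + ε p k
        ≡⟨ arithmetic (+ n₀) (ε p k) ⟩
      + p - + 4 + ε p k ∎
    where
      open ≡-Reasoning
      χf : ℕ → ℤ
      χf m = χ (f (+ k) (+ m))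
      arithmetic : ∀ n e → n + - + 1 + - + 2 + e ≡ (+ 1 + n) - + 4 + e
      arithmetic = solve-∀

  -- The m = 1 term of Σ* χf₁ is χ(f₁(1)) = χ(-3).
  column-∞-sum : ∀ n₁ → n₀ ≡ suc n₁ → sumℤ (λ x → + 1 + χ (f (+ suc (suc x)) (+ 1))) n₁ ≡ + p - + 3 - legendre (+ p) 3
  column-∞-sum n₁ refl = begin
      sumℤ (λ x → + 1 + χ (f (+ suc (suc x)) (+ 1))) n₁
        ≡⟨ sumℤ-cong n₁ (λ x _ → cong (_+_ (+ 1)) (χf₁-symmetric (suc (suc x)))) ⟩
      sumℤ (λ x → + 1 + χf₁ (suc (suc x))) n₁
        ≡⟨ trans (sumℤ-+ _ _ n₁) (cong (_+ rest) (sumℤ-1 n₁)) ⟩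
      + n₁ + rest
        ≡⟨ cong (_+_ (+ n₁)) rest≡ ⟩
      + n₁ + (- + 1 - χ (- + 3))
        ≡⟨ cong (λ w → + n₁ + (- + 1 - w)) χ[-3]≡[p/3] ⟩
      + n₁ + (- + 1 - legendre (+ p) 3)
        ≡⟨ arithmetic (+ n₁) (legendre (+ p) 3) ⟩
      + p - + 3 - legendre (+ p) 3 ∎
    where
      open ≡-Reasoning
      rest = sumℤ (λ x → χf₁ (suc (suc x))) n₁
      rest≡ : rest ≡ - + 1 - χ (- + 3)
      rest≡ = +-cancelˡ (χ (- + 3)) _ _ (trans (trans (sym (sumℤ-suc (λ x → χf₁ (suc x)) n₁)) Σ*-χ-f₁) (move (χ (- + 3))))
        where move : ∀ c → - + 1 ≡ c + (- + 1 - c)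
              move = solve-∀
      arithmetic : ∀ n l → n + (- + 1 - l) ≡ + 2 + n - + 3 - l
      arithmetic = solve-∀

module MatrixT {c ℓ′} (R : CommutativeRing c ℓ′) (p : ℕ) (s : CommutativeRing.Carrier R) where
  private module R = CommutativeRing R
  open R using (Carrier; _≈_; _+_; _*_; -_; 0#; 1#)
  open RingProperties R.ring using (-‿involutive; -0#≈0#; -‿+-comm; -‿distribˡ-*; -‿distribʳ-*)
  open MultProperties R.semiring using (×-homo-+; ×1-homo-*; ×-congˡ) renaming (_×_ to _×′_)
  open import Relation.Binary.Reasoning.Setoid R.setoid
  open Mat R p s using (ι; sumR; T)

  ι-⊖ : ∀ m n → ι (m ⊖ n) ≈ (m ×′ 1#) + - (n ×′ 1#)
  ι-⊖ m zero rewrite ℤP.⊖-≥ {m} {0} z≤n = R.sym (R.trans (R.+-congˡ -0#≈0#) (R.+-identityʳ _))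
  ι-⊖ zero (suc n) rewrite ℤP.⊖-< {0} {suc n} (s≤s z≤n) = R.sym (R.+-identityˡ _)
  ι-⊖ (suc m) (suc n) rewrite ℤP.[1+m]⊖[1+n]≡m⊖n m n = begin
      ι (m ⊖ n)                                  ≈⟨ ι-⊖ m n ⟩
      M + - N                                    ≈⟨ R.+-identityˡ _ ⟨
      0# + (M + - N)                             ≈⟨ R.+-congʳ (R.-‿inverseʳ 1#) ⟨
      (1# + - 1#) + (M + - N)                    ≈⟨ R.+-assoc 1# (- 1#) _ ⟩
      1# + (- 1# + (M + - N))                    ≈⟨ R.+-congˡ (R.trans (R.sym (R.+-assoc (- 1#) M _))
                                                     (R.trans (R.+-congʳ (R.+-comm (- 1#) M)) (R.+-assoc M (- 1#) _))) ⟩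
      1# + (M + (- 1# + - N))                    ≈⟨ R.+-assoc 1# M _ ⟨
      (1# + M) + (- 1# + - N)                    ≈⟨ R.+-congˡ (-‿+-comm 1# N) ⟩
      (1# + M) + - (1# + N)                      ∎
    where M = m ×′ 1#
          N = n ×′ 1#

  ι-+ : ∀ a b → ι (a ℤ.+ b) ≈ ι a + ι b
  ι-+ (+ m) (+ n) = ×-homo-+ 1# m n
  ι-+ (+ m) -[1+ n ] = ι-⊖ m (suc n)
  ι-+ -[1+ m ] (+ n) = R.trans (ι-⊖ n (suc m)) (R.+-comm _ _)
  ι-+ -[1+ m ] -[1+ n ] = begin
      - (suc (suc (m ℕ.+ n)) ×′ 1#)        ≈⟨ R.-‿cong (×-congˡ (cong suc (sym (ℕP.+-suc m n)))) ⟩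
      - ((suc m ℕ.+ suc n) ×′ 1#)          ≈⟨ R.-‿cong (×-homo-+ 1# (suc m) (suc n)) ⟩
      - ((suc m ×′ 1#) + (suc n ×′ 1#))     ≈⟨ -‿+-comm _ _ ⟨
      - (suc m ×′ 1#) + - (suc n ×′ 1#)     ∎

  ι-neg : ∀ a → ι (ℤ.- a) ≈ - ι a
  ι-neg (+ zero) = R.sym -0#≈0#
  ι-neg (+ suc n) = R.refl
  ι-neg -[1+ n ] = R.sym (-‿involutive _)

  ι-pos-* : ∀ m n → ι (+ m ℤ.* + n) ≈ ι (+ m) * ι (+ n)
  ι-pos-* m n = R.trans (R.reflexive (cong ι (sym (ℤP.pos-* m n)))) (×1-homo-* m n)

  ι-* : ∀ a b → ι (a ℤ.* b) ≈ ι a * ι b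
  ι-* (+ m) (+ n) = ι-pos-* m n
  ι-* (+ m) -[1+ n ] = begin
      ι (+ m ℤ.* -[1+ n ])           ≡⟨ cong ι (ℤP.neg-distribʳ-* (+ m) (+ suc n)) ⟨
      ι (ℤ.- (+ m ℤ.* + suc n))      ≈⟨ ι-neg (+ m ℤ.* + suc n) ⟩
      - ι (+ m ℤ.* + suc n)          ≈⟨ R.-‿cong (ι-pos-* m (suc n)) ⟩
      - (ι (+ m) * ι (+ suc n))      ≈⟨ -‿distribʳ-* _ _ ⟩
      ι (+ m) * - ι (+ suc n)        ∎
  ι-* -[1+ m ] (+ n) = begin
      ι (-[1+ m ] ℤ.* + n)           ≡⟨ cong ι (ℤP.neg-distribˡ-* (+ suc m) (+ n)) ⟨
      ι (ℤ.- (+ suc m ℤ.* + n))      ≈⟨ ι-neg (+ suc m ℤ.* + n) ⟩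
      - ι (+ suc m ℤ.* + n)          ≈⟨ R.-‿cong (ι-pos-* (suc m) n) ⟩
      - (ι (+ suc m) * ι (+ n))      ≈⟨ -‿distribˡ-* _ _ ⟩
      - ι (+ suc m) * ι (+ n)        ∎
  ι-* -[1+ m ] -[1+ n ] = begin
      ι (+ suc m ℤ.* + suc n)               ≈⟨ ι-pos-* (suc m) (suc n) ⟩
      ι (+ suc m) * ι (+ suc n)             ≈⟨ R.*-cong (-‿involutive _) (-‿involutive _) ⟨
      - - ι (+ suc m) * - - ι (+ suc n)     ≈⟨ -‿distribˡ-* _ _ ⟨
      - (- ι (+ suc m) * - - ι (+ suc n))   ≈⟨ R.-‿cong (-‿distribʳ-* _ _) ⟨
      - - (- ι (+ suc m) * - ι (+ suc n))   ≈⟨ -‿involutive _ ⟩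
      - ι (+ suc m) * - ι (+ suc n)         ∎

  sumR-cong : ∀ {g h : ℕ → Carrier} n → (∀ m → 1 ℕ.≤ m → m ℕ.≤ n → g m ≈ h m) → sumR g n ≈ sumR h n
  sumR-cong zero _ = R.refl
  sumR-cong (suc n) eq = R.+-cong (sumR-cong n (λ m 1≤m m≤n → eq m 1≤m (ℕP.m≤n⇒m≤1+n m≤n))) (eq (suc n) (s≤s z≤n) ℕP.≤-refl)

  sumR-zero : ∀ (g : ℕ → Carrier) n → (∀ m → 1 ℕ.≤ m → m ℕ.≤ n → g m ≈ 0#) → sumR g n ≈ 0#
  sumR-zero g n g≈0 = R.trans (sumR-cong n g≈0) (zeros n)
    where zeros : ∀ n → sumR (λ _ → 0#) n ≈ 0#
          zeros zero = R.refl
          zeros (suc n) = R.trans (R.+-identityʳ _) (zeros n)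

  sumR-ι : ∀ (h : ℕ → ℤ) n → sumR (λ m → ι (h m)) n ≈ ι (sumℤ (λ x → h (suc x)) n)
  sumR-ι h zero = R.refl
  sumR-ι h (suc n) = R.trans (R.+-congʳ (sumR-ι h n)) (R.sym (ι-+ (sumℤ (λ x → h (suc x)) n) (h (suc n))))

  sumR-suc : ∀ (g : ℕ → Carrier) n → sumR g (suc n) ≈ g 1 + sumR (λ m → g (suc m)) n
  sumR-suc g zero = R.trans (R.+-identityˡ _) (R.sym (R.+-identityʳ _))
  sumR-suc g (suc n) = R.trans (R.+-congʳ (sumR-suc g n)) (R.+-assoc _ _ _)

  <p⇒≢p+2 : ∀ {i} → i ℕ.< p → i ≢ p ℕ.+ 2
  <p⇒≢p+2 i<p refl = ℕP.<-irrefl refl (ℕP.<-≤-trans i<p (ℕP.m≤m+n p 2))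

  T-finite : ∀ {i j} → i ℕ.< p → j ℕ.< p → T i j ≡ ι (+ 1 ℤ.+ legendre (f (+ j) (+ i)) p)
  T-finite {i} {j} i<p j<p
    rewrite dec-false (i ℕ.≟ p ℕ.+ 2) (<p⇒≢p+2 i<p) | dec-false (j ℕ.≟ p ℕ.+ 2) (<p⇒≢p+2 j<p)
          | dec-true (i ℕ.<? p) i<p | dec-true (j ℕ.<? p) j<p = refl

  T-finite-∞ : ∀ {i j} → i ℕ.< p → ¬ j ℕ.< p → j ≢ p ℕ.+ 2 → T i j ≡ (if i ≡ᵇ 1 then 0# else 1#)
  T-finite-∞ {i} {j} i<p j≮p j≢p+2
    rewrite dec-false (i ℕ.≟ p ℕ.+ 2) (<p⇒≢p+2 i<p)
          | dec-false (j ℕ.≟ p ℕ.+ 2) j≢p+2 | dec-true (i ℕ.<? p) i<p | dec-false (j ℕ.<? p) j≮p = refl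

  T-last-row : ∀ {i j} → i ≡ p ℕ.+ 2 → T i j ≡ (if j ≡ᵇ 1 then s else 0#)
  T-last-row {i} i≡p+2 rewrite dec-true (i ℕ.≟ p ℕ.+ 2) i≡p+2 = refl

  T-last-column : ∀ {i j} → i ≢ p ℕ.+ 2 → j ≡ p ℕ.+ 2 → T i j ≡ (if i ≡ᵇ 1 then s else 0#)
  T-last-column {i} {j} i≢p+2 j≡p+2 rewrite dec-false (i ℕ.≟ p ℕ.+ 2) i≢p+2 | dec-true (j ℕ.≟ p ℕ.+ 2) j≡p+2 = refl

  T-last-row-≢1 : ∀ {j} → j ≢ 1 → T (suc (suc p)) j ≡ 0#
  T-last-row-≢1 {j} j≢1 rewrite T-last-row {suc (suc p)} {j} (ℕP.+-comm 2 p) | dec-false (j ℕ.≟ 1) j≢1 = refl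

module FirstRowOfT² {c ℓ′} (R : CommutativeRing c ℓ′) (n₁ : ℕ) (p-prime : Prime (suc (suc n₁)))
                    (5≤p : 5 ℕ.≤ suc (suc n₁)) (s : CommutativeRing.Carrier R) where
  module R = CommutativeRing R
  open R using (Carrier; _≈_; _+_; _*_; 0#; 1#)
  open import Relation.Binary.Reasoning.Setoid R.setoid

  n₀ : ℕ
  n₀ = suc n₁

  p : ℕ
  p = suc n₀

  open Mat R p s using (ι; sumR; T; T²₁)
  open MatrixT R p s
  open Residues n₀ p-prime 5≤p using (χ; Σ*; column₁-sum; column-sum; column-∞-sum; χ[-3]≡[p/3])

  private
    1<p : 1 ℕ.< p
    1<p = s≤s (s≤s z≤n)

    p+2≡ : suc (suc p) ≡ p ℕ.+ 2
    p+2≡ = ℕP.+-comm 2 p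

    1≢p+2 : 1 ≢ p ℕ.+ 2
    1≢p+2 = <p⇒≢p+2 1<p

    ≡0⇒*≈0 : ∀ {x y} → y ≡ 0# → x * y ≈ 0#
    ≡0⇒*≈0 {x} refl = R.zeroʳ x

    m≤n₀⇒m<p : ∀ {m} → m ℕ.≤ n₀ → m ℕ.< p
    m≤n₀⇒m<p = s≤s

  -- Row 1 of T vanishes in columns p and p + 1 and equals s in column p + 2.
  T²₁-split : ∀ k → T²₁ k ≈ sumR (λ m → T 1 m * T m k) n₀ + s * T (suc (suc p)) k
  T²₁-split k = begin
      T²₁ k
        ≡⟨ cong (λ n → sumR g (suc n)) (ℕP.+-comm n₀ 2) ⟩
      ((sumR g n₀ + T 1 p * T p k) + T 1 (suc p) * T (suc p) k) + T 1 (suc (suc p)) * T (suc (suc p)) k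
        ≈⟨ R.+-cong (R.+-cong (R.+-cong R.refl (≡0⇒0*≈0 T₁,p≡0)) (≡0⇒0*≈0 T₁,p+1≡0))
                    (R.*-congʳ (R.reflexive (T-last-column 1≢p+2 p+2≡))) ⟩
      ((sumR g n₀ + 0#) + 0#) + s * T (suc (suc p)) k
        ≈⟨ R.+-congʳ (R.trans (R.+-identityʳ _) (R.+-identityʳ _)) ⟩
      sumR g n₀ + s * T (suc (suc p)) k ∎
    where
      g : ℕ → Carrier
      g m = T 1 m * T m k
      ≡0⇒0*≈0 : ∀ {x y} → x ≡ 0# → x * y ≈ 0#
      ≡0⇒0*≈0 {y = y} refl = R.zeroˡ y
      T₁,p≡0 : T 1 p ≡ 0#
      T₁,p≡0 = T-finite-∞ 1<p (ℕP.<-irrefl refl) (λ p≡p+2 → ℕP.<-irrefl p≡p+2 (ℕP.m<m+n p (s≤s z≤n)))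
      T₁,p+1≡0 : T 1 (suc p) ≡ 0#
      T₁,p+1≡0 = T-finite-∞ 1<p (λ p+1<p → ℕP.<-asym p+1<p (ℕP.n<1+n p))
                   (λ p+1≡p+2 → ℕP.<-irrefl (trans p+1≡p+2 (sym p+2≡)) (ℕP.n<1+n (suc p)))

  finite-block : ∀ k → k ℕ.< p →
                 sumR (λ m → T 1 m * T m k) n₀ ≈ ι (Σ* (λ m → (+ 1 ℤ.+ χ (f (+ m) (+ 1))) ℤ.* (+ 1 ℤ.+ χ (f (+ k) (+ m)))))
  finite-block k k<p =
    R.trans (sumR-cong n₀ (λ m _ m≤n₀ →
               R.trans (R.*-cong (R.reflexive (T-finite 1<p (m≤n₀⇒m<p m≤n₀))) (R.reflexive (T-finite (m≤n₀⇒m<p m≤n₀) k<p)))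
                       (R.sym (ι-* (+ 1 ℤ.+ χ (f (+ m) (+ 1))) (+ 1 ℤ.+ χ (f (+ k) (+ m)))))))
            (sumR-ι (λ m → (+ 1 ℤ.+ χ (f (+ m) (+ 1))) ℤ.* (+ 1 ℤ.+ χ (f (+ k) (+ m)))) n₀)

  T²₁-1 : s * s ≈ ι (+ n₀) → T²₁ 1 ≈ ι (+ (3 ℕ.* p) ℤ.- + 6)
  T²₁-1 s²≈p-1 = begin
      T²₁ 1                                                     ≈⟨ T²₁-split 1 ⟩
      sumR (λ m → T 1 m * T m 1) n₀ + s * T (suc (suc p)) 1     ≈⟨ R.+-cong (finite-block 1 1<p) (R.*-congˡ (R.reflexive (T-last-row {j = 1} p+2≡))) ⟩
      ι (Σ* (λ m → (+ 1 ℤ.+ χ (f (+ m) (+ 1))) ℤ.* (+ 1 ℤ.+ χ (f (+ 1) (+ m))))) + s * s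
                                                                ≈⟨ R.+-congˡ s²≈p-1 ⟩
      ι (Σ* (λ m → (+ 1 ℤ.+ χ (f (+ m) (+ 1))) ℤ.* (+ 1 ℤ.+ χ (f (+ 1) (+ m))))) + ι (+ n₀)
                                                                ≈⟨ ι-+ (Σ* (λ m → (+ 1 ℤ.+ χ (f (+ m) (+ 1))) ℤ.* (+ 1 ℤ.+ χ (f (+ 1) (+ m))))) (+ n₀) ⟨
      ι (Σ* (λ m → (+ 1 ℤ.+ χ (f (+ m) (+ 1))) ℤ.* (+ 1 ℤ.+ χ (f (+ 1) (+ m)))) ℤ.+ + n₀)
                                                                ≡⟨ cong ι column₁-sum ⟩
      ι (+ (3 ℕ.* p) ℤ.- + 6)                                   ∎

  T²₁-finite : ∀ k → 2 ℕ.≤ k → k ℕ.≤ n₀ → T²₁ k ≈ ι (+ p ℤ.- + 4 ℤ.+ ε p k)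
  T²₁-finite k 2≤k k≤n₀ = begin
      T²₁ k                                                     ≈⟨ T²₁-split k ⟩
      sumR (λ m → T 1 m * T m k) n₀ + s * T (suc (suc p)) k     ≈⟨ R.+-cong (finite-block k (m≤n₀⇒m<p k≤n₀)) (≡0⇒*≈0 (T-last-row-≢1 k≢1)) ⟩
      ι (Σ* (λ m → (+ 1 ℤ.+ χ (f (+ m) (+ 1))) ℤ.* (+ 1 ℤ.+ χ (f (+ k) (+ m))))) + 0#
                                                                ≈⟨ R.+-identityʳ _ ⟩
      ι (Σ* (λ m → (+ 1 ℤ.+ χ (f (+ m) (+ 1))) ℤ.* (+ 1 ℤ.+ χ (f (+ k) (+ m)))))
                                                                ≡⟨ cong ι (column-sum k 2≤k (m≤n₀⇒m<p k≤n₀)) ⟩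
      ι (+ p ℤ.- + 4 ℤ.+ ε p k)                                 ∎
    where k≢1 : k ≢ 1
          k≢1 refl = ℕP.<-irrefl refl 2≤k

  -- Columns p and p + 1 of T agree with the all-ones vector except in row 1.
  T²₁-∞ : ∀ k → ¬ k ℕ.< p → k ≢ p ℕ.+ 2 → T²₁ k ≈ ι (+ p ℤ.- + 3 ℤ.- ℓ p)
  T²₁-∞ k k≮p k≢p+2 = begin
      T²₁ k                                                     ≈⟨ T²₁-split k ⟩
      sumR g n₀ + s * T (suc (suc p)) k                         ≈⟨ R.+-cong (sumR-suc g n₁) (≡0⇒*≈0 (T-last-row-≢1 k≢1)) ⟩
      (g 1 + sumR (λ m → g (suc m)) n₁) + 0#                    ≈⟨ R.+-identityʳ _ ⟩
      g 1 + sumR (λ m → g (suc m)) n₁                           ≈⟨ R.+-cong (≡0⇒*≈0 (T-finite-∞ 1<p k≮p k≢p+2)) (sumR-cong n₁ later) ⟩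
      0# + sumR (λ m → ι (+ 1 ℤ.+ χ (f (+ suc m) (+ 1)))) n₁    ≈⟨ R.+-identityˡ _ ⟩
      sumR (λ m → ι (+ 1 ℤ.+ χ (f (+ suc m) (+ 1)))) n₁         ≈⟨ sumR-ι (λ m → + 1 ℤ.+ χ (f (+ suc m) (+ 1))) n₁ ⟩
      ι (sumℤ (λ x → + 1 ℤ.+ χ (f (+ suc (suc x)) (+ 1))) n₁)   ≡⟨ cong ι (column-∞-sum n₁ refl) ⟩
      ι (+ p ℤ.- + 3 ℤ.- ℓ p)                                   ∎
    where
      g : ℕ → Carrier
      g m = T 1 m * T m k
      k≢1 : k ≢ 1
      k≢1 refl = k≮p 1<p
      later : ∀ m → 1 ℕ.≤ m → m ℕ.≤ n₁ → g (suc m) ≈ ι (+ 1 ℤ.+ χ (f (+ suc m) (+ 1)))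
      later (suc m) _ m≤n₁ =
        R.trans (R.*-congˡ (R.reflexive (T-finite-∞ (s≤s (s≤s m≤n₁)) k≮p k≢p+2)))
                (R.trans (R.*-identityʳ _) (R.reflexive (T-finite 1<p (s≤s (s≤s m≤n₁)))))

  T²₁-p+2 : T²₁ (p ℕ.+ 2) ≈ ι (+ 1 ℤ.+ ℓ p) * s
  T²₁-p+2 = begin
      T²₁ (p ℕ.+ 2)                                             ≈⟨ T²₁-split (p ℕ.+ 2) ⟩
      sumR g n₀ + s * T (suc (suc p)) (p ℕ.+ 2)                 ≈⟨ R.+-cong (sumR-suc g n₁) (≡0⇒*≈0 (T-last-row-≢1 (λ p+2≡1 → 1≢p+2 (sym p+2≡1)))) ⟩
      (g 1 + sumR (λ m → g (suc m)) n₁) + 0#                    ≈⟨ R.+-identityʳ _ ⟩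
      g 1 + sumR (λ m → g (suc m)) n₁                           ≈⟨ R.+-cong (R.*-cong (R.reflexive (T-finite 1<p 1<p)) (R.reflexive (T-last-column 1≢p+2 refl)))
                                                                            (sumR-zero _ n₁ later) ⟩
      ι (+ 1 ℤ.+ χ (ℤ.- + 3)) * s + 0#                            ≈⟨ R.+-identityʳ _ ⟩
      ι (+ 1 ℤ.+ χ (ℤ.- + 3)) * s                                 ≡⟨ cong (λ l → ι (+ 1 ℤ.+ l) * s) χ[-3]≡[p/3] ⟩
      ι (+ 1 ℤ.+ ℓ p) * s                                       ∎
    where
      g : ℕ → Carrier
      g m = T 1 m * T m (p ℕ.+ 2)
      later : ∀ m → 1 ℕ.≤ m → m ℕ.≤ n₁ → g (suc m) ≈ 0#
      later (suc m) _ m≤n₁ = ≡0⇒*≈0 (T-last-column (<p⇒≢p+2 (s≤s (s≤s m≤n₁))) refl)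

open import Data.Nat using (_≤_; _+_; _*_; _∸_)

lemma8 : ∀ {c ℓ′} (R : CommutativeRing c ℓ′) (p : ℕ) → Prime p → 5 ≤ p →
         (s : CommutativeRing.Carrier R) →
         CommutativeRing._≈_ R (CommutativeRing._*_ R s s) (Mat.ι R p s (+ (p ∸ 1))) →
         CommutativeRing._≈_ R (Mat.T²₁ R p s 1) (Mat.ι R p s (+ (3 * p) ℤ.- + 6))
         × (∀ k → 2 ≤ k → k ≤ p ∸ 1 →
              CommutativeRing._≈_ R (Mat.T²₁ R p s k) (Mat.ι R p s (+ p ℤ.- + 4 ℤ.+ ε p k)))
         × CommutativeRing._≈_ R (Mat.T²₁ R p s p) (Mat.ι R p s (+ p ℤ.- + 3 ℤ.- ℓ p))
         × CommutativeRing._≈_ R (Mat.T²₁ R p s (p + 1)) (Mat.ι R p s (+ p ℤ.- + 3 ℤ.- ℓ p))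
         × CommutativeRing._≈_ R (Mat.T²₁ R p s (p + 2))
             (CommutativeRing._*_ R (Mat.ι R p s (+ 1 ℤ.+ ℓ p)) s)
lemma8 R zero _ ()
lemma8 R (suc zero) _ (s≤s ())
lemma8 R p@(suc (suc n₁)) p-prime 5≤p s s²≈p-1 =
    T²₁-1 s²≈p-1
  , T²₁-finite
  , T²₁-∞ p (ℕP.n≮n p) (λ p≡p+2 → ℕP.<-irrefl p≡p+2 (ℕP.m<m+n p (s≤s z≤n)))
  , T²₁-∞ (p + 1) (ℕP.m+n≮m p 1) (λ p+1≡p+2 → ℕP.<-irrefl p+1≡p+2 (ℕP.+-monoʳ-< p (ℕP.n<1+n 1)))
  , T²₁-p+2
  where open FirstRowOfT² R n₁ p-prime 5≤p s using (T²₁-1; T²₁-finite; T²₁-∞; T²₁-p+2)
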